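{- Let $k\ge 1$ and let $r\ge 2$ be even. Then for any $r$-uniform cgh $H$ on $\Omega_n$, \[ |S_k(H)| \ge r|H| - (r-1)(k-1)|\partial H|. \]
   Context: $\Omega_n$ is a set of $n$ points in strictly convex position in the plane with cyclic (clockwise) ordering $\prec$. An $r$-uniform cgh on $\Omega_n$ is a set $H$ of $r$-subsets of $\Omega_n$; $|H|$ is its number of edges and $\partial H=\{e\setminus\{x\}: x\in e\in H\}$ its shadow. Segments of $\Omega_n$ are sets of cyclically consecutive points, each linearly ordered clockwise; disjoint segments satisfy $I_0 \prec \dots \prec I_{r-1}$ if they appear in this order going once around clockwise. For even $r$, a $k$-zigzag in $H$ is a sequence of distinct points $v_0,\dots,v_{k+r-2}$ with $\{v_i,\dots,v_{i+r-1}\}\in H$ for $0\le i<k$, for which there are disjoint segments $I_0 \prec \dots \prec I_{r-1}$ with $\{v_i : i\equiv j \pmod r\}\subseteq I_j$, such that for even $j$: $v_j \prec v_{j+r} \prec \cdots$ in $I_j$, and for odd $j$: $v_j \succ v_{j+r}\succ \cdots$ in $I_j$. The end of such a $k$-zigzag is the $r$-tuple $(v_{k-1},v_k,\dots,v_{k+r-2})$, and $S_k(H)$ is the set of all ends of $k$-zigzags in $H$. -}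

module Defs where

open import Data.Nat using (ℕ; zero; suc; _+_; _*_; _∸_; _≤_; _<_; _≤ᵇ_)
open import Data.Nat.Divisibility using (_∣_)
open import Data.Bool using (Bool; true; false; if_then_else_)
open import Data.Fin using (Fin; toℕ)
open import Data.Fin.Subset using (Subset; ⁅_⁆; _∪_; ⊥; _-_)
open import Data.Vec using (Vec; tabulate; lookup)
import Data.Vec.Properties as VecP
import Data.Bool.Properties as BoolP
open import Data.List using (List; []; _∷_; concatMap; allFin; length; deduplicate)
open import Data.List.Membership.Propositional using (_∈_)
open import Data.Product using (Σ; ∃; _×_)
open import Relation.Nullary using (¬_)
open import Relation.Binary.PropositionalEquality using (_≡_)

-- Points of Ω_n are Fin n; the clockwise cyclic order is 0 → 1 → … → n-1 → 0.
-- Only the cyclic order of the points in convex position matters.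

-- An r-uniform cgh on Ω_n: a duplicate-free list of subsets each of size r
-- (see Statement); |H| = length of the list.
CGH : ℕ → Set
CGH n = List (Subset n)

shadowOf : ∀ {n} → Subset n → List (Subset n)
shadowOf {n} e = concatMap (λ x → if lookup e x then (e - x) ∷ [] else []) (allFin n)

shadow : ∀ {n} → CGH n → List (Subset n)
shadow H = deduplicate (VecP.≡-dec BoolP._≟_) (concatMap shadowOf H)

window : ∀ {n} → (ℕ → Fin n) → ℕ → ℕ → Subset n
window v i zero    = ⊥
window v i (suc m) = ⁅ v i ⁆ ∪ window v (suc i) m

-- Clockwise distance from base point b to p (in {0,…,n-1}).
rel : ∀ {n} → Fin n → Fin n → ℕ
rel {n} b p = if toℕ b ≤ᵇ toℕ p then toℕ p ∸ toℕ b else (toℕ p + n) ∸ toℕ b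

-- r disjoint segments I_0 ≺ I_1 ≺ … ≺ I_{r-1} of Ω_n in clockwise order:
-- reading clockwise from a base point b, segment I_j consists of the points p
-- with  lo j ≤ rel b p < hi j, where  lo 0 ≤ hi 0 ≤ lo 1 ≤ hi 1 ≤ … ≤ hi (r-1) ≤ n.
-- Inside I_j the clockwise linear order is the order of rel b.
record Segments (n r : ℕ) : Set where
  field
    base : Fin n
    lo hi : ℕ → ℕ
    lo≤hi : ∀ j → j < r → lo j ≤ hi j
    hi≤lo : ∀ j → suc j < r → hi j ≤ lo (suc j)
    last≤n : hi (r ∸ 1) ≤ n

-- v is a k-zigzag in H (r even) with respect to the segments I;
-- v is relevant on indices 0,…,k+r-2.
record IsZigzagWith {n : ℕ} (r k : ℕ) (H : CGH n) (v : ℕ → Fin n) (I : Segments n r) : Set where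
  open Segments I
  field
    distinct : ∀ i j → i < k + r ∸ 1 → j < k + r ∸ 1 → v i ≡ v j → i ≡ j
    edges : ∀ i → i < k → window v i r ∈ H
    inSeg : ∀ j q → j < r → j + q * r < k + r ∸ 1 →
              (lo j ≤ rel base (v (j + q * r))) × (rel base (v (j + q * r)) < hi j)
    evenIncr : ∀ j q → j < r → 2 ∣ j → j + suc q * r < k + r ∸ 1 →
              rel base (v (j + q * r)) < rel base (v (j + suc q * r))
    oddDecr : ∀ j q → j < r → ¬ (2 ∣ j) → j + suc q * r < k + r ∸ 1 →
              rel base (v (j + suc q * r)) < rel base (v (j + q * r))

IsZigzag : ∀ {n : ℕ} (r k : ℕ) (H : CGH n) (v : ℕ → Fin n) → Set
IsZigzag {n} r k H v = Σ (Segments n r) (IsZigzagWith r k H v)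

endOf : ∀ {n} (r k : ℕ) → (ℕ → Fin n) → Vec (Fin n) r
endOf r k v = tabulate (λ j → v ((k ∸ 1) + toℕ j))

InS : ∀ {n : ℕ} (r k : ℕ) (H : CGH n) → Vec (Fin n) r → Set
InS {n} r k H t = ∃ λ (v : ℕ → Fin n) → IsZigzag r k H v × endOf r k v ≡ t

-- Base (k = 1): for x ∈ e ∈ H, listing e clockwise from x is a 1-zigzag,
-- and distinct pairs (e, x) give distinct ends: |S_1(H)| ≥ r|H|.
-- Step: if a ∷ t and a' ∷ t are ends of k-zigzags and a' has the smaller
-- gap to the tail t (distance to the first point of t, or from its last
-- point, depending on the parity of a's residue class), then the zigzag
-- ending in a ∷ t continues with a', so t ∷ʳ a' ∈ S_{k+1}(H) (gluing).  So
-- only the end with the largest gap in each tail class may be lost, and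
-- such an end is determined by its shadow set (a ∷ t) ∖ {a} ∈ ∂H together
-- with the first point of t, because tails are sorted clockwise.  Hence at
-- most (r−1)|∂H| ends are lost per step.

module Submission where

open import Defs

open import Data.Bool using (Bool; true; false; T; if_then_else_)
import Data.Bool.Properties as BoolP
open import Data.Empty using (⊥-elim) renaming (⊥ to ⊥')
open import Data.Fin using (Fin; toℕ; zero; suc)
open import Data.Fin.Properties using (toℕ<n; toℕ-injective) renaming (suc-injective to Fin-suc-injective)
open import Data.Fin.Subset using (Subset; ⁅_⁆; _∪_; _-_; _─_; ∣_∣; inside; outside)
  renaming (⊥ to ∅; _∈_ to _∈ₛ_)
open import Data.Fin.Subset.Properties
  using (⊆-antisym; x∈p∪q⁻; x∈p∪q⁺; x∈⁅x⁆; x∈⁅y⁆⇒x≡y; ∉⊥; x∈p∧x≢y⇒x∈p-y; x∈p⇒∣p-x∣<∣p∣;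
         ∪-identityˡ; ∪-identityʳ; ∪-assoc; ∪-comm; p─q⊆p)
import Data.Integer as ℤ
import Data.Integer.Properties as ℤ
import Data.Integer.Tactic.RingSolver as ℤ-Solver
open import Data.List using (List; []; _∷_; _++_; map; filter; length; concatMap; allFin; deduplicate)
open import Data.List.Properties using (length-map; length-++)
open import Data.List.Membership.Propositional using (_∈_)
open import Data.List.Membership.Propositional.Properties
  using (∈-∃++; ∈-++⁻; ∈-++⁺ˡ; ∈-++⁺ʳ; ∈-map⁺; ∈-map⁻; ∈-filter⁻;
         ∈-concatMap⁺; ∈-concatMap⁻; ∈-deduplicate⁺; ∈-deduplicate⁻; ∈-allFin)
open import Data.List.Relation.Binary.Permutation.Propositional using (_↭_; ↭-sym; ↭⇒↭ₛ)
open import Data.List.Relation.Binary.Permutation.Propositional.Properties using (∈-resp-↭; ↭-length)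
import Data.List.Relation.Binary.Permutation.Setoid.Properties as PermutationSetoid
open import Data.List.Relation.Unary.All using (All; []; _∷_)
import Data.List.Relation.Unary.All as All
open import Data.List.Relation.Unary.AllPairs using (AllPairs; []; _∷_)
import Data.List.Relation.Unary.AllPairs as AllPairs
open import Data.List.Relation.Unary.Any using (Any; any?)
import Data.List.Relation.Unary.Any as Any
open import Data.List.Relation.Unary.Sorted.TotalOrder.Properties using (Sorted⇒AllPairs)
open import Data.List.Relation.Unary.Unique.Propositional using (Unique)
import Data.List.Relation.Unary.Unique.Propositional.Properties as Unique
import Data.List.Sort.InsertionSort as InsertionSort
import Data.List.Sort.InsertionSort.Properties as InsertionSortProperties
open import Data.Nat using (ℕ; zero; suc; _+_; _*_; _∸_; _≤_; _<_; _≤ᵇ_; z≤n; s≤s; _≤?_; _<?_; _≟_)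
open import Data.Nat.Divisibility using (_∣_; _∣?_; divides; ∣m+n∣m⇒∣n; ∣1⇒≡1)
open import Data.Nat.DivMod using (_%_; _/_; m%n<n; m≡m%n+[m/n]*n; [m+kn]%n≡m%n; [m+n]%n≡m%n; m<n⇒m%n≡m)
open import Data.Nat.Properties
open import Data.Nat.Tactic.RingSolver using (solve-∀)
open import Data.Product using (∃; _×_; _,_; proj₁; proj₂)
open import Data.Sum using (_⊎_; inj₁; inj₂)
open import Data.Vec using (Vec; _∷_; []; here; there; tabulate; head; tail; last; _∷ʳ_; lookup)
open import Data.Vec.Properties using (∷-injective; ∷ʳ-injective; last-∷ʳ; []=⇒lookup; lookup⇒[]=)
import Data.Vec.Properties as VecP
open import Function using (_∘_)
open import Level using (0ℓ)
open import Relation.Binary using (tri<; tri≈; tri>; DecTotalOrder)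
import Relation.Binary.Construct.On as On
open import Relation.Binary.PropositionalEquality
open import Relation.Nullary using (¬_; ¬?; yes; no; Dec; does)
open import Relation.Nullary.Decidable using (_×-dec_)
open import Relation.Unary using (Decidable)

rel-cases : ∀ {n} (b p : Fin n) →
  (toℕ b + rel b p ≡ toℕ p) ⊎ (toℕ p < toℕ b × toℕ b + rel b p ≡ toℕ p + n)
rel-cases {n} b p with toℕ b ≤ᵇ toℕ p in eq
... | true  = inj₁ (m+[n∸m]≡n (≤ᵇ⇒≤ (toℕ b) (toℕ p) (subst T (sym eq) _)))
... | false = inj₂ (p<b , m+[n∸m]≡n {toℕ b} {toℕ p + n} (≤-trans (<⇒≤ (toℕ<n b)) (m≤n+m n (toℕ p))))
  where
  p<b : toℕ p < toℕ b
  p<b = ≰⇒> (λ le → subst T eq (≤⇒≤ᵇ le))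

rel-offset : ∀ {n} (b p : Fin n) → ∃ λ c → (c ≡ 0 ⊎ c ≡ n) × toℕ b + rel b p ≡ toℕ p + c
rel-offset b p with rel-cases b p
... | inj₁ e = 0 , inj₁ refl , trans e (sym (+-identityʳ _))
... | inj₂ (_ , e) = _ , inj₂ refl , e

<n-≢-+n : ∀ {a b n} → a < n → a ≢ b + n
<n-≢-+n {a} {b} {n} lt e = <⇒≱ lt (subst (n ≤_) (sym e) (m≤n+m n b))

rel<n : ∀ {n} (b p : Fin n) → rel b p < n
rel<n {n} b p with rel-cases b p
... | inj₁ e = +-cancelˡ-< (toℕ b) _ _ (subst (_< toℕ b + n) (sym e) (≤-trans (toℕ<n p) (m≤n+m n (toℕ b))))
... | inj₂ (lt , e) = +-cancelˡ-< (toℕ b) _ _ (subst (_< toℕ b + n) (sym e) (+-monoˡ-< n lt))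

rel≡0⇒≡ : ∀ {n} (b p : Fin n) → rel b p ≡ 0 → b ≡ p
rel≡0⇒≡ b p z with rel-cases b p
... | inj₁ e = toℕ-injective (trans (sym (+-identityʳ (toℕ b))) (trans (cong (toℕ b +_) (sym z)) e))
... | inj₂ (_ , e) = ⊥-elim (<n-≢-+n (toℕ<n b) (trans (sym (trans (cong (toℕ b +_) z) (+-identityʳ (toℕ b)))) e))

rel-self : ∀ {n} (b : Fin n) → rel b b ≡ 0
rel-self b with rel-cases b b
... | inj₁ e = +-cancelˡ-≡ (toℕ b) _ _ (trans e (sym (+-identityʳ (toℕ b))))
... | inj₂ (lt , _) = ⊥-elim (<-irrefl refl lt)

rel-injectiveʳ : ∀ {n} (b : Fin n) {p q : Fin n} → rel b p ≡ rel b q → p ≡ q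
rel-injectiveʳ {n} b {p} {q} e with rel-offset b p | rel-offset b q
... | c₁ , o₁ , e₁ | c₂ , o₂ , e₂ = toℕ-injective (go o₁ o₂ (trans (sym e₁) (trans (cong (toℕ b +_) e) e₂)))
  where
  go : ∀ {c₁ c₂} → c₁ ≡ 0 ⊎ c₁ ≡ n → c₂ ≡ 0 ⊎ c₂ ≡ n → toℕ p + c₁ ≡ toℕ q + c₂ → toℕ p ≡ toℕ q
  go (inj₁ refl) (inj₁ refl) e = +-cancelʳ-≡ 0 _ _ e
  go (inj₂ refl) (inj₂ refl) e = +-cancelʳ-≡ n _ _ e
  go (inj₁ refl) (inj₂ refl) e = ⊥-elim (<n-≢-+n (toℕ<n p) (trans (sym (+-identityʳ _)) e))
  go (inj₂ refl) (inj₁ refl) e = ⊥-elim (<n-≢-+n (toℕ<n q) (trans (sym (+-identityʳ _)) (sym e)))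

rel-injectiveˡ : ∀ {n} (b : Fin n) {p q : Fin n} → rel p b ≡ rel q b → p ≡ q
rel-injectiveˡ {n} b {p} {q} e with rel-offset p b | rel-offset q b
... | c₁ , o₁ , e₁ | c₂ , o₂ , e₂ = toℕ-injective (go o₁ o₂ e₁ (subst (λ z → toℕ q + z ≡ toℕ b + c₂) (sym e) e₂))
  where
  ρ : ℕ
  ρ = rel p b
  swap : ∀ a c n → a + c + n ≡ a + n + c
  swap = solve-∀
  go : ∀ {c₁ c₂} → c₁ ≡ 0 ⊎ c₁ ≡ n → c₂ ≡ 0 ⊎ c₂ ≡ n →
       toℕ p + ρ ≡ toℕ b + c₁ → toℕ q + ρ ≡ toℕ b + c₂ → toℕ p ≡ toℕ q
  go (inj₁ refl) (inj₁ refl) e₁ e₂ = +-cancelʳ-≡ ρ _ _ (trans e₁ (sym e₂))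
  go (inj₂ refl) (inj₂ refl) e₁ e₂ = +-cancelʳ-≡ ρ _ _ (trans e₁ (sym e₂))
  go (inj₁ refl) (inj₂ refl) e₁ e₂ = ⊥-elim (<n-≢-+n (toℕ<n q) (+-cancelʳ-≡ ρ _ _
    (trans e₂ (trans (cong (_+ n) (trans (sym (+-identityʳ _)) (sym e₁))) (swap (toℕ p) ρ n)))))
  go (inj₂ refl) (inj₁ refl) e₁ e₂ = ⊥-elim (<n-≢-+n (toℕ<n p) (+-cancelʳ-≡ ρ _ _
    (trans e₁ (trans (cong (_+ n) (trans (sym (+-identityʳ _)) (sym e₂))) (swap (toℕ q) ρ n)))))

arc-sum : ∀ {n} (b x y : Fin n) →
  (rel b x + rel x y ≡ rel b y) ⊎ (rel b x + rel x y ≡ rel b y + n)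
arc-sum {n} b x y with rel-offset b x | rel-offset x y | rel-offset b y
... | c₁ , o₁ , e₁ | c₂ , o₂ , e₂ | c₃ , o₃ , e₃ = go o₁ o₂ o₃ (+-cancelˡ-≡ (toℕ b) _ _ (begin
    toℕ b + (X + ρ + c₃)       ≡⟨ ring₁ (toℕ b) X ρ c₃ ⟩
    (toℕ b + X) + ρ + c₃       ≡⟨ cong (λ z → z + ρ + c₃) e₁ ⟩
    (toℕ x + c₁) + ρ + c₃      ≡⟨ ring₂ (toℕ x) c₁ ρ c₃ ⟩
    (toℕ x + ρ) + (c₁ + c₃)    ≡⟨ cong (_+ (c₁ + c₃)) e₂ ⟩
    (toℕ y + c₂) + (c₁ + c₃)   ≡⟨ ring₃ (toℕ y) c₂ c₁ c₃ ⟩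
    (toℕ y + c₃) + (c₁ + c₂)   ≡⟨ cong (_+ (c₁ + c₂)) (sym e₃) ⟩
    (toℕ b + Y) + (c₁ + c₂)    ≡⟨ +-assoc (toℕ b) Y (c₁ + c₂) ⟩
    toℕ b + (Y + (c₁ + c₂))    ∎))
  where
  open ≡-Reasoning
  X ρ Y : ℕ
  X = rel b x
  ρ = rel x y
  Y = rel b y
  ring₁ : ∀ b X ρ c → b + (X + ρ + c) ≡ (b + X) + ρ + c
  ring₁ = solve-∀
  ring₂ : ∀ x c₁ ρ c₃ → (x + c₁) + ρ + c₃ ≡ (x + ρ) + (c₁ + c₃)
  ring₂ = solve-∀
  ring₃ : ∀ y c₂ c₁ c₃ → (y + c₂) + (c₁ + c₃) ≡ (y + c₃) + (c₁ + c₂)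
  ring₃ = solve-∀
  sum<2n : X + ρ < n + n
  sum<2n = +-mono-< (rel<n b x) (rel<n x y)
  go : ∀ {c₁ c₂ c₃} → c₁ ≡ 0 ⊎ c₁ ≡ n → c₂ ≡ 0 ⊎ c₂ ≡ n → c₃ ≡ 0 ⊎ c₃ ≡ n →
       X + ρ + c₃ ≡ Y + (c₁ + c₂) → (X + ρ ≡ Y) ⊎ (X + ρ ≡ Y + n)
  go (inj₁ refl) (inj₁ refl) (inj₁ refl) e = inj₁ (+-cancelʳ-≡ 0 _ _ e)
  go (inj₁ refl) (inj₂ refl) (inj₁ refl) e = inj₂ (+-cancelʳ-≡ 0 _ _ (trans e (sym (+-identityʳ _))))
  go (inj₂ refl) (inj₁ refl) (inj₁ refl) e = inj₂ (+-cancelʳ-≡ 0 _ _ (trans e (sym (+-assoc Y n 0))))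
  go (inj₂ refl) (inj₂ refl) (inj₁ refl) e = ⊥-elim (<n-≢-+n {b = Y} sum<2n (trans (sym (+-identityʳ _)) e))
  go (inj₁ refl) (inj₁ refl) (inj₂ refl) e = ⊥-elim (<n-≢-+n (rel<n b y) (sym (trans e (+-identityʳ Y))))
  go (inj₁ refl) (inj₂ refl) (inj₂ refl) e = inj₁ (+-cancelʳ-≡ n _ _ e)
  go (inj₂ refl) (inj₁ refl) (inj₂ refl) e = inj₁ (+-cancelʳ-≡ n _ _ (trans e (cong (Y +_) (+-identityʳ n))))
  go (inj₂ refl) (inj₂ refl) (inj₂ refl) e = inj₂ (+-cancelʳ-≡ n _ _ (trans e (sym (+-assoc Y n n))))

arc-sum-≤ : ∀ {n} (b x y : Fin n) → rel b x ≤ rel b y → rel b x + rel x y ≡ rel b y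
arc-sum-≤ {n} b x y le with arc-sum b x y
... | inj₁ e = e
... | inj₂ e = ⊥-elim (<⇒≱ (rel<n x y) (+-cancelˡ-≤ (rel b x) _ _ (begin
    rel b x + n        ≤⟨ +-monoˡ-≤ n le ⟩
    rel b y + n        ≡⟨ sym e ⟩
    rel b x + rel x y  ∎)))
  where open ≤-Reasoning

arc-sum-> : ∀ {n} (b x y : Fin n) → rel b y < rel b x → rel b x + rel x y ≡ rel b y + n
arc-sum-> b x y lt with arc-sum b x y
... | inj₂ e = e
... | inj₁ e = ⊥-elim (<⇒≱ lt (subst (rel b x ≤_) e (m≤m+n (rel b x) (rel x y))))

arc-sum-≡⇒≡ : ∀ {n} (b x y : Fin n) → rel b x + rel x y ≡ rel b y → rel b x ≡ rel b y → x ≡ y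
arc-sum-≡⇒≡ b x y e eq = rel≡0⇒≡ x y (+-cancelˡ-≡ (rel b x) _ _ (trans e (trans (sym eq) (sym (+-identityʳ _)))))

closer-to⇒between : ∀ {n} (b a a' t : Fin n) → rel b a < rel b t → a' ≢ t → rel a' t < rel a t →
  rel b a < rel b a' × rel b a' < rel b t
closer-to⇒between {n} b a a' t a<t a'≢t closer with rel b a' ≤? rel b t
... | yes a'≤t = a<a' , ≤∧≢⇒< a'≤t (a'≢t ∘ arc-sum-≡⇒≡ b a' t e₂)
  where
  e₁ : rel b a + rel a t ≡ rel b t
  e₁ = arc-sum-≤ b a t (<⇒≤ a<t)
  e₂ : rel b a' + rel a' t ≡ rel b t
  e₂ = arc-sum-≤ b a' t a'≤t
  a<a' : rel b a < rel b a'
  a<a' = ≰⇒> (λ a'≤a → <-irrefl (trans e₂ (sym e₁)) (+-mono-≤-< a'≤a closer))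
... | no t<a' = ⊥-elim (<-irrefl (arc-sum-> b a' t (≰⇒> t<a')) (begin-strict
    rel b a' + rel a' t  <⟨ +-mono-< (rel<n b a') (<-≤-trans closer (m≤n+m (rel a t) (rel b a))) ⟩
    n + (rel b a + rel a t)  ≡⟨ cong (n +_) (arc-sum-≤ b a t (<⇒≤ a<t)) ⟩
    n + rel b t          ≡⟨ +-comm n (rel b t) ⟩
    rel b t + n          ∎))
  where open ≤-Reasoning

closer-from⇒between : ∀ {n} (b l a a' : Fin n) → rel b l < rel b a → a' ≢ l → rel l a' < rel l a →
  rel b l < rel b a' × rel b a' < rel b a
closer-from⇒between {n} b l a a' l<a a'≢l closer with rel b l ≤? rel b a'
... | yes l≤a' = ≤∧≢⇒< l≤a' (a'≢l ∘ sym ∘ arc-sum-≡⇒≡ b l a' e₂) ,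
                 subst₂ _<_ e₂ e₁ (+-monoʳ-< (rel b l) closer)
  where
  e₁ : rel b l + rel l a ≡ rel b a
  e₁ = arc-sum-≤ b l a (<⇒≤ l<a)
  e₂ : rel b l + rel l a' ≡ rel b a'
  e₂ = arc-sum-≤ b l a' l≤a'
... | no a'<l = ⊥-elim (<-irrefl (arc-sum-> b l a' (≰⇒> a'<l)) (begin-strict
    rel b l + rel l a'  <⟨ +-monoʳ-< (rel b l) closer ⟩
    rel b l + rel l a   ≡⟨ arc-sum-≤ b l a (<⇒≤ l<a) ⟩
    rel b a             <⟨ rel<n b a ⟩
    n                   ≤⟨ m≤n+m n (rel b a') ⟩
    rel b a' + n        ∎))
  where open ≤-Reasoning

window-cong : ∀ {n} (f g : ℕ → Fin n) i m → (∀ j → j < m → f (i + j) ≡ g (i + j)) →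
  window f i m ≡ window g i m
window-cong f g i zero h = refl
window-cong f g i (suc m) h =
  cong₂ _∪_ (cong ⁅_⁆ (subst (λ z → f z ≡ g z) (+-identityʳ i) (h 0 (s≤s z≤n))))
            (window-cong f g (suc i) m (λ j lt → subst (λ z → f z ≡ g z) (+-suc i j) (h (suc j) (s≤s lt))))

window-snoc : ∀ {n} (f : ℕ → Fin n) i m → window f i (suc m) ≡ window f i m ∪ ⁅ f (i + m) ⁆
window-snoc f i zero =
  trans (∪-identityʳ _) (trans (cong ⁅_⁆ (cong f (sym (+-identityʳ i)))) (sym (∪-identityˡ _)))
window-snoc f i (suc m) = trans (cong (⁅ f i ⁆ ∪_) (window-snoc f (suc i) m))
  (trans (sym (∪-assoc ⁅ f i ⁆ _ _)) (cong (λ z → (⁅ f i ⁆ ∪ window f (suc i) m) ∪ ⁅ f z ⁆) (sym (+-suc i m))))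

∈-window⁻ : ∀ {n} (f : ℕ → Fin n) i m {x} → x ∈ₛ window f i m → ∃ λ j → j < m × f (i + j) ≡ x
∈-window⁻ f i zero h = ⊥-elim (∉⊥ h)
∈-window⁻ f i (suc m) h with x∈p∪q⁻ ⁅ f i ⁆ (window f (suc i) m) h
... | inj₁ h₁ = 0 , s≤s z≤n , trans (cong f (+-identityʳ i)) (sym (x∈⁅y⁆⇒x≡y _ h₁))
... | inj₂ h₂ with ∈-window⁻ f (suc i) m h₂
...   | j , lt , e = suc j , s≤s lt , trans (cong f (+-suc i j)) e

∈-window⁺ : ∀ {n} (f : ℕ → Fin n) i m j → j < m → f (i + j) ∈ₛ window f i m
∈-window⁺ f i (suc m) zero lt =
  x∈p∪q⁺ (inj₁ (subst (λ z → f z ∈ₛ ⁅ f i ⁆) (sym (+-identityʳ i)) (x∈⁅x⁆ (f i))))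
∈-window⁺ f i (suc m) (suc j) (s≤s lt) =
  x∈p∪q⁺ (inj₂ (subst (λ z → f z ∈ₛ window f (suc i) m) (sym (+-suc i j)) (∈-window⁺ f (suc i) m j lt)))

x∈p-y⁻ : ∀ {n} {p : Subset n} {x y} → x ∈ₛ p - y → x ∈ₛ p × x ≢ y
x∈p-y⁻ {p = p} {x} {y} h = p─q⊆p p ⁅ y ⁆ h , λ eq → disjoint p ⁅ y ⁆ h (subst (_∈ₛ ⁅ y ⁆) (sym eq) (x∈⁅x⁆ y))
  where
  disjoint : ∀ {n} (p q : Subset n) {x} → x ∈ₛ p ─ q → x ∈ₛ q → ⊥'
  disjoint (s ∷ p) (inside ∷ q) () here
  disjoint (s ∷ p) (t ∷ q) (there a) (there b) = disjoint p q a b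

vset : ∀ {n p} → Vec (Fin n) p → Subset n
vset [] = ∅
vset (x ∷ xs) = ⁅ x ⁆ ∪ vset xs

tab : ∀ {A : Set} p → (ℕ → A) → Vec A p
tab p g = tabulate (λ j → g (toℕ j))

tab-cong : ∀ {A : Set} p (f g : ℕ → A) → (∀ j → j < p → f j ≡ g j) → tab p f ≡ tab p g
tab-cong zero f g h = refl
tab-cong (suc p) f g h =
  cong₂ _∷_ (h 0 (s≤s z≤n)) (tab-cong p (λ x → f (suc x)) (λ x → g (suc x)) (λ j lt → h (suc j) (s≤s lt)))

tab-injective : ∀ {A : Set} p (f g : ℕ → A) → tab p f ≡ tab p g → ∀ j → j < p → f j ≡ g j
tab-injective (suc p) f g eq zero lt = proj₁ (∷-injective eq)
tab-injective (suc p) f g eq (suc j) (s≤s lt) =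
  tab-injective p (λ x → f (suc x)) (λ x → g (suc x)) (proj₂ (∷-injective eq)) j lt

tab-snoc : ∀ {A : Set} p (g : ℕ → A) → tab (suc p) g ≡ tab p g ∷ʳ g p
tab-snoc zero g = refl
tab-snoc (suc p) g = cong (g 0 ∷_) (tab-snoc p (λ x → g (suc x)))

last-tab : ∀ {A : Set} p (g : ℕ → A) → last (tab (suc p) g) ≡ g p
last-tab p g = trans (cong last (tab-snoc p g)) (last-∷ʳ (g p) (tab p g))

vset-tab : ∀ {n} p (g : ℕ → Fin n) i → vset (tab p (λ j → g (i + j))) ≡ window g i p
vset-tab zero g i = refl
vset-tab (suc p) g i = cong₂ _∪_ (cong ⁅_⁆ (cong g (+-identityʳ i))) (begin
  vset (tab p (λ j → g (i + suc j)))  ≡⟨ cong vset (tab-cong p _ _ (λ j _ → cong g (+-suc i j))) ⟩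
  vset (tab p (λ j → g (suc i + j)))  ≡⟨ vset-tab p g (suc i) ⟩
  window g (suc i) p                  ∎)
  where open ≡-Reasoning

∈-vset-tab⁻ : ∀ {n} p (g : ℕ → Fin n) {x} → x ∈ₛ vset (tab p g) → ∃ λ j → j < p × g j ≡ x
∈-vset-tab⁻ p g h = ∈-window⁻ g 0 p (subst (_ ∈ₛ_) (vset-tab p g 0) h)

∈-vset-tab⁺ : ∀ {n} p (g : ℕ → Fin n) j → j < p → g j ∈ₛ vset (tab p g)
∈-vset-tab⁺ p g j lt = subst (g j ∈ₛ_) (sym (vset-tab p g 0)) (∈-window⁺ g 0 p j lt)

even⇒¬even-suc : ∀ x → 2 ∣ x → ¬ (2 ∣ suc x)
even⇒¬even-suc x ev od with ∣1⇒≡1 (∣m+n∣m⇒∣n (subst (2 ∣_) (+-comm 1 x) od) ev)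
... | ()

even⊎even-suc : ∀ x → (2 ∣ x) ⊎ (2 ∣ suc x)
even⊎even-suc zero = inj₁ (divides 0 refl)
even⊎even-suc (suc x) with even⊎even-suc x
... | inj₁ (divides q eq) = inj₂ (divides (suc q) (trans (cong (λ z → suc (suc z)) (trans eq (*-comm q 2))) (double q)))
  where
  double : ∀ q → suc (suc (2 * q)) ≡ suc q * 2
  double = solve-∀
... | inj₂ od = inj₁ od

¬even-suc⇒even : ∀ x → ¬ (2 ∣ suc x) → 2 ∣ x
¬even-suc⇒even x ne with even⊎even-suc x
... | inj₁ ev = ev
... | inj₂ od = ⊥-elim (ne od)

-- Residues modulo r = suc P.  Position i of a zigzag lies in the segment
-- with index  res i  and is the  quo i -th point visited there.
module Residues (P : ℕ) where
  r : ℕ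
  r = suc P

  res quo : ℕ → ℕ
  res i = i % r
  quo i = i / r

  res<r : ∀ i → res i < r
  res<r i = m%n<n i r

  res+quo : ∀ i → i ≡ res i + quo i * r
  res+quo i = m≡m%n+[m/n]*n i r

  res-of : ∀ j q → j < r → res (j + q * r) ≡ j
  res-of j q lt = trans ([m+kn]%n≡m%n j q r) (m<n⇒m%n≡m lt)

  quo-of : ∀ j q → j < r → quo (j + q * r) ≡ q
  quo-of j q lt = sym (*-cancelʳ-≡ q _ r (+-cancelˡ-≡ j _ _
    (subst (λ z → j + q * r ≡ z + quo (j + q * r) * r) (res-of j q lt) (res+quo (j + q * r)))))

  res-quo-unique : ∀ j q j' q' → j < r → j' < r → j + q * r ≡ j' + q' * r → j ≡ j' × q ≡ q'
  res-quo-unique j q j' q' lt lt' e =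
    trans (sym (res-of j q lt)) (trans (cong res e) (res-of j' q' lt')) ,
    trans (sym (quo-of j q lt)) (trans (cong quo e) (quo-of j' q' lt'))

  res-shift : ∀ s i → res (s + i) ≡ res (res s + i)
  res-shift s i = trans (cong (λ z → res (z + i)) (res+quo s))
                        (trans (cong res (swap (res s) (quo s * r) i)) ([m+kn]%n≡m%n (res s + i) (quo s) r))
    where
    swap : ∀ a b c → a + b + c ≡ a + c + b
    swap = solve-∀

  res-unwrapped : ∀ s i → res s + i < r → res (s + i) ≡ res s + i
  res-unwrapped s i lt = trans (res-shift s i) (m<n⇒m%n≡m lt)

  wrapped<res : ∀ s i → i < r → r ≤ res s + i → res s + i ∸ r < res s
  wrapped<res s i lt le = subst (res s + i ∸ r <_) (m+n∸n≡m (res s) r) (∸-monoˡ-< (+-monoʳ-< (res s) lt) le)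

  res-wrapped : ∀ s i → i < r → r ≤ res s + i → res (s + i) ≡ res s + i ∸ r
  res-wrapped s i lt le = trans (res-shift s i) (trans (cong res (sym (m∸n+n≡m le)))
    (trans ([m+n]%n≡m%n (res s + i ∸ r) r) (m<n⇒m%n≡m (<-trans (wrapped<res s i lt le) (res<r s)))))

  quo-≤ : ∀ j q q' → j + q * r < j + q' * r + r → q ≤ q'
  quo-≤ j q q' h = ≤-pred (*-cancelʳ-< r q (suc q') (subst (q * r <_) (+-comm (q' * r) r)
    (+-cancelˡ-< j _ _ (subst (j + q * r <_) (+-assoc j (q' * r) r) h))))

module SegmentFacts {n r : ℕ} (I : Segments n r) where
  open Segments I

  seg-order : ∀ j j' → j < j' → j' < r → hi j ≤ lo j'
  seg-order j (suc j') (s≤s j≤j') lt with m≤n⇒m<n∨m≡n j≤j'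
  ... | inj₂ refl = hi≤lo j lt
  ... | inj₁ j<j' = ≤-trans (seg-order j j' j<j' j'<r) (≤-trans (lo≤hi j' j'<r) (hi≤lo j' lt))
    where
    j'<r : j' < r
    j'<r = <-trans (n<1+n j') lt

  seg-unique : ∀ {j j' x} → j < r → j' < r → lo j ≤ x × x < hi j → lo j' ≤ x × x < hi j' → j ≡ j'
  seg-unique {j} {j'} {x} jl j'l (l , u) (l' , u') with <-cmp j j'
  ... | tri< c _ _ = ⊥-elim (<⇒≱ u (≤-trans (seg-order j j' c j'l) l'))
  ... | tri≈ _ e _ = e
  ... | tri> _ _ c = ⊥-elim (<⇒≱ u' (≤-trans (seg-order j' j c jl) l))

k+r∸1≡k+P : ∀ k P → k + suc P ∸ 1 ≡ k + P
k+r∸1≡k+P k P = cong (_∸ 1) (+-suc k P)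

module ZigzagFacts {n P k : ℕ} {H : CGH n} {v : ℕ → Fin n}
                   (I : Segments n (suc P)) (Z : IsZigzagWith (suc P) k H v I) where
  open Residues P
  open Segments I
  open SegmentFacts I using (seg-order)
  open IsZigzagWith Z

  X : ℕ → ℕ
  X i = rel base (v i)

  inRange : ∀ {i} → i < k + P → i < k + suc P ∸ 1
  inRange {i} lt = subst (i <_) (sym (k+r∸1≡k+P k P)) lt

  X∈seg : ∀ i → i < k + P → lo (res i) ≤ X i × X i < hi (res i)
  X∈seg i lt with inSeg (res i) (quo i) (res<r i) (inRange (subst (_< k + P) (res+quo i) lt))
  ... | l , u = subst (λ z → lo (res i) ≤ rel base (v z)) (sym (res+quo i)) l ,
                subst (λ z → rel base (v z) < hi (res i)) (sym (res+quo i)) u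

  res<⇒X< : ∀ i i' → i < k + P → i' < k + P → res i < res i' → X i < X i'
  res<⇒X< i i' lt lt' c =
    <-≤-trans (proj₂ (X∈seg i lt)) (≤-trans (seg-order (res i) (res i') c (res<r i')) (proj₁ (X∈seg i' lt')))

  private
    step-bound : ∀ j q → j + suc q * r < k + P → j + q * r < k + P
    step-bound j q = ≤-<-trans (+-monoʳ-≤ j (*-monoˡ-≤ r (n≤1+n q)))

  even-mono : ∀ j q q' → j < r → 2 ∣ j → q ≤ q' → j + q' * r < k + P → X (j + q * r) ≤ X (j + q' * r)
  even-mono j q zero jl ev z≤n h = ≤-refl
  even-mono j q (suc q') jl ev le h with m≤n⇒m<n∨m≡n le
  ... | inj₂ refl = ≤-refl
  ... | inj₁ (s≤s q≤q') = ≤-trans (even-mono j q q' jl ev q≤q' (step-bound j q' h))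
                                  (<⇒≤ (evenIncr j q' jl ev (inRange h)))

  odd-mono : ∀ j q q' → j < r → ¬ (2 ∣ j) → q ≤ q' → j + q' * r < k + P → X (j + q' * r) ≤ X (j + q * r)
  odd-mono j q zero jl od z≤n h = ≤-refl
  odd-mono j q (suc q') jl od le h with m≤n⇒m<n∨m≡n le
  ... | inj₂ refl = ≤-refl
  ... | inj₁ (s≤s q≤q') = ≤-trans (<⇒≤ (oddDecr j q' jl od (inRange h)))
                                  (odd-mono j q q' jl od q≤q' (step-bound j q' h))

  -- Any r consecutive points s, …, s + r - 1 of a zigzag are in clockwise
  -- order starting from the first: the positions s + j with res s + j < r
  -- lie in later segments than s, the others (wrapped around) in earlier ones.
  window-sorted : ∀ s j j' → j < j' → j' < r → s + j' < k + P →
                  rel (v s) (v (s + j)) < rel (v s) (v (s + j'))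
  window-sorted s j j' j<j' j'<r bound = +-cancelˡ-< (X s) _ _ (go (side j (<-trans j<j' j'<r) j-in) (side j' j'<r bound))
    where
    c₀ : ℕ
    c₀ = res s

    j-in : s + j < k + P
    j-in = <-trans (+-monoʳ-< s j<j') bound

    Side : ℕ → Set
    Side i = (c₀ + i < r × X s ≤ X (s + i)) ⊎ (r ≤ c₀ + i × X (s + i) < X s)

    s-in : s < k + P
    s-in = ≤-<-trans (m≤m+n s j) j-in

    side : ∀ i → i < r → s + i < k + P → Side i
    side i lt il with c₀ + i <? r
    ... | no nl = inj₂ (≮⇒≥ nl , res<⇒X< (s + i) s il s-in
                          (subst (_< c₀) (sym (res-wrapped s i lt (≮⇒≥ nl))) (wrapped<res s i lt (≮⇒≥ nl))))
    side zero lt il | yes l = inj₁ (l , ≤-reflexive (cong X (sym (+-identityʳ s))))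
    side (suc i) lt il | yes l = inj₁ (l , <⇒≤ (res<⇒X< s (s + suc i) s-in il
                                    (subst (c₀ <_) (sym (res-unwrapped s (suc i) l)) (m<m+n c₀ (s≤s z≤n)))))

    -- By arc-sum, X s + rel (v s) (v (s + i)) is X (s + i) on the first side
    -- and X (s + i) + n on the second; compare by segment order.
    go : Side j → Side j' → X s + rel (v s) (v (s + j)) < X s + rel (v s) (v (s + j'))
    go (inj₁ (u , a)) (inj₁ (u' , a')) = subst₂ _<_ (sym (arc-sum-≤ base (v s) _ a)) (sym (arc-sum-≤ base (v s) _ a'))
      (res<⇒X< (s + j) (s + j') j-in bound (subst₂ _<_ (sym (res-unwrapped s j u)) (sym (res-unwrapped s j' u')) (+-monoʳ-< c₀ j<j')))
    go (inj₂ (w , a)) (inj₂ (w' , a')) = subst₂ _<_ (sym (arc-sum-> base (v s) _ a)) (sym (arc-sum-> base (v s) _ a'))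
      (+-monoˡ-< n (res<⇒X< (s + j) (s + j') j-in bound
        (subst₂ _<_ (sym (res-wrapped s j (<-trans j<j' j'<r) w)) (sym (res-wrapped s j' j'<r w')) (∸-monoˡ-< (+-monoʳ-< c₀ j<j') w))))
    go (inj₁ (u , a)) (inj₂ (w' , a')) = subst₂ _<_ (sym (arc-sum-≤ base (v s) _ a)) (sym (arc-sum-> base (v s) _ a'))
      (<-≤-trans (rel<n base (v (s + j))) (m≤n+m n (X (s + j'))))
    go (inj₂ (w , a)) (inj₁ (u' , a')) = ⊥-elim (<⇒≱ u' (≤-trans w (<⇒≤ (+-monoʳ-< c₀ j<j'))))

  private
    same-class : ∀ i b → res i ≡ res b → i ≡ res b + quo i * r
    same-class i b e = trans (res+quo i) (cong (_+ quo i * r) e)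

    quo-le : ∀ i b → res i ≡ res b → i < b + r → quo i ≤ quo b
    quo-le i b e lt = quo-≤ (res b) (quo i) (quo b) (subst₂ _<_ (same-class i b e) (cong (_+ r) (res+quo b)) lt)

  even-latest : ∀ i b → res i ≡ res b → 2 ∣ res b → i < b + r → b < k + P → X i ≤ X b
  even-latest i b e ev lt bl = subst₂ (λ x y → X x ≤ X y) (sym (same-class i b e)) (sym (res+quo b))
    (even-mono (res b) (quo i) (quo b) (res<r b) ev (quo-le i b e lt) (subst (_< k + P) (res+quo b) bl))

  odd-latest : ∀ i b → res i ≡ res b → ¬ (2 ∣ res b) → i < b + r → b < k + P → X b ≤ X i
  odd-latest i b e od lt bl = subst₂ (λ x y → X x ≤ X y) (sym (res+quo b)) (sym (same-class i b e))
    (odd-mono (res b) (quo i) (quo b) (res<r b) od (quo-le i b e lt) (subst (_< k + P) (res+quo b) bl))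

pick : ∀ {A : Set} → Dec A → ℕ → ℕ → ℕ
pick (yes _) a b = a
pick (no _) a b = b

module Cut {n P : ℕ} (I : Segments n (suc P)) (j c : ℕ) (sj<r : suc j < suc P)
           (lo≤c : Segments.lo I j ≤ c) (c≤hi : c ≤ Segments.hi I (suc j)) where
  open Segments I

  lo' hi' : ℕ → ℕ
  lo' i = pick (i ≟ suc j) c (lo i)
  hi' i = pick (i ≟ j) c (hi i)

  private
    j≢sj : j ≢ suc j
    j≢sj e = <-irrefl e (n<1+n j)

  lo'≤hi' : ∀ i → i < suc P → lo' i ≤ hi' i
  lo'≤hi' i il with i ≟ j | i ≟ suc j
  ... | yes refl | yes e = ⊥-elim (j≢sj e)
  ... | yes refl | no _ = lo≤c
  ... | no _ | yes refl = c≤hi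
  ... | no _ | no _ = lo≤hi i il

  hi'≤lo' : ∀ i → suc i < suc P → hi' i ≤ lo' (suc i)
  hi'≤lo' i il with i ≟ j | suc i ≟ suc j
  ... | yes refl | yes _ = ≤-refl
  ... | yes refl | no ne = ⊥-elim (ne refl)
  ... | no i≢j | yes e = ⊥-elim (i≢j (suc-injective e))
  ... | no _ | no _ = hi≤lo i il

  hi'-last : hi' P ≤ n
  hi'-last with P ≟ j
  ... | yes refl = ⊥-elim (<-irrefl refl (≤-pred sj<r))
  ... | no _ = last≤n

  cut : Segments n (suc P)
  cut = record { base = base ; lo = lo' ; hi = hi' ; lo≤hi = lo'≤hi' ; hi≤lo = hi'≤lo' ; last≤n = hi'-last }

  cut-below : ∀ {x} → lo j ≤ x → x < c → lo' j ≤ x × x < hi' j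
  cut-below l u with j ≟ suc j | j ≟ j
  ... | yes e | _ = ⊥-elim (j≢sj e)
  ... | no _ | yes _ = l , u
  ... | no _ | no ne = ⊥-elim (ne refl)

  cut-above : ∀ {x} → c ≤ x → x < hi (suc j) → lo' (suc j) ≤ x × x < hi' (suc j)
  cut-above l u with suc j ≟ suc j | suc j ≟ j
  ... | yes _ | yes e = ⊥-elim (j≢sj (sym e))
  ... | yes _ | no _ = l , u
  ... | no ne | _ = ⊥-elim (ne refl)

  cut-mem : ∀ i {x} → lo i ≤ x × x < hi i → (i ≡ j → x < c) → (i ≡ suc j → c ≤ x) → lo' i ≤ x × x < hi' i
  cut-mem i (l , u) below above with i ≟ j | i ≟ suc j
  ... | yes refl | yes e = ⊥-elim (j≢sj e)
  ... | yes refl | no _ = l , below refl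
  ... | no _ | yes refl = above refl , u
  ... | no _ | no _ = l , u

setAt : ∀ {n} (v : ℕ → Fin n) (N : ℕ) (a : Fin n) → ℕ → Fin n
setAt v N a i with i ≟ N
... | yes _ = a
... | no _ = v i

setAt-here : ∀ {n} (v : ℕ → Fin n) N a → setAt v N a N ≡ a
setAt-here v N a with N ≟ N
... | yes _ = refl
... | no ne = ⊥-elim (ne refl)

setAt-other : ∀ {n} (v : ℕ → Fin n) N a i → i ≢ N → setAt v N a i ≡ v i
setAt-other v N a i ne with i ≟ N
... | yes e = ⊥-elim (ne e)
... | no _ = refl

<1+n∧≢⇒< : ∀ {i N} → i < suc N → i ≢ N → i < N
<1+n∧≢⇒< lt = ≤∧≢⇒< (m<1+n⇒m≤n lt)

-- A (suc m)-zigzag v has its points at positions 0 … N-1, N = suc m + P.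
-- Appending a' at position N gives a (suc m + 1)-zigzag, with new segment
-- boundaries taken from J (the base point stays that of I), as soon as:
-- all old points stay in their new segments, a' lies in the new segment
-- of its residue class res m, a' continues the class of position m in the
-- right direction, and the last r points form an edge.  (That a' is a new
-- point follows: it would share a segment, hence the class, with an old
-- point, contradicting the monotonicity of that class.)
module Extension {n P m : ℕ} {H : CGH n} {v : ℕ → Fin n}
                 (I : Segments n (suc P)) (Z : IsZigzagWith (suc P) (suc m) H v I) where
  open Residues P
  open Segments I
  open IsZigzagWith Z
  open ZigzagFacts I Z

  N : ℕ
  N = suc m + P

  N≡m+r : N ≡ m + r
  N≡m+r = sym (+-suc m P)

  N≡res-m+ : N ≡ res m + suc (quo m) * r
  N≡res-m+ = trans N≡m+r (trans (cong (_+ r) (res+quo m)) (regroup (res m) (quo m * r) r))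
    where
    regroup : ∀ a b c → a + b + c ≡ a + (c + b)
    regroup = solve-∀

  res-N : res N ≡ res m
  res-N = trans (cong res N≡m+r) ([m+n]%n≡m%n m r)

  m<N : m < N
  m<N = s≤s (m≤m+n m P)

  private
    bound : ∀ {i} → i < suc (suc m) + suc P ∸ 1 → i < suc N
    bound {i} lt = subst (i <_) (+-suc (suc m) P) lt

  module Append (a' : Fin n) (J : Segments n r)
    (old-in : ∀ i → i < N → Segments.lo J (res i) ≤ X i × X i < Segments.hi J (res i))
    (new-in : Segments.lo J (res m) ≤ rel base a' × rel base a' < Segments.hi J (res m))
    (even-step : 2 ∣ res m → X m < rel base a')
    (odd-step : ¬ (2 ∣ res m) → rel base a' < X m)
    (edge : ⁅ a' ⁆ ∪ window v (suc m) P ∈ H) where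
    module J = Segments J
    w : ℕ → Fin n
    w = setAt v N a'

    fresh : ∀ i → i < N → v i ≢ a'
    fresh i lt eq = go (2 ∣? res m)
      where
      i<m+r : i < m + r
      i<m+r = subst (i <_) N≡m+r lt
      same : res i ≡ res m
      same = SegmentFacts.seg-unique J (res<r i) (res<r m) (old-in i lt)
               (subst (λ x → J.lo (res m) ≤ rel base x × rel base x < J.hi (res m)) (sym eq) new-in)
      go : Dec (2 ∣ res m) → ⊥'
      go (yes ev) = <⇒≱ (even-step ev) (subst (λ x → rel base x ≤ X m) eq (even-latest i m same ev i<m+r m<N))
      go (no od) = <⇒≱ (odd-step od) (subst (λ x → X m ≤ rel base x) eq (odd-latest i m same od i<m+r m<N))

    old : ∀ {i} → i ≢ N → w i ≡ v i
    old {i} = setAt-other v N a' i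

    new : w N ≡ a'
    new = setAt-here v N a'

    distinct' : ∀ i j → i < suc (suc m) + r ∸ 1 → j < suc (suc m) + r ∸ 1 → w i ≡ w j → i ≡ j
    distinct' i j li lj eq = go (i ≟ N) (j ≟ N)
      where
      go : Dec (i ≡ N) → Dec (j ≡ N) → i ≡ j
      go (yes e₁) (yes e₂) = trans e₁ (sym e₂)
      go (yes e₁) (no n₂) = ⊥-elim (fresh j (<1+n∧≢⇒< (bound lj) n₂) (trans (sym (old n₂)) (trans (sym eq) (trans (cong w e₁) new))))
      go (no n₁) (yes e₂) = ⊥-elim (fresh i (<1+n∧≢⇒< (bound li) n₁) (trans (sym (old n₁)) (trans eq (trans (cong w e₂) new))))
      go (no n₁) (no n₂) = distinct i j (inRange (<1+n∧≢⇒< (bound li) n₁)) (inRange (<1+n∧≢⇒< (bound lj) n₂))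
                             (trans (sym (old n₁)) (trans eq (old n₂)))

    edges' : ∀ i → i < suc (suc m) → window w i r ∈ H
    edges' i lt = go (i ≟ suc m)
      where
      go : Dec (i ≡ suc m) → window w i r ∈ H
      go (yes refl) = subst (_∈ H) (sym last-window) edge
        where
        last-window : window w (suc m) r ≡ ⁅ a' ⁆ ∪ window v (suc m) P
        last-window = trans (window-snoc w (suc m) P)
          (trans (cong₂ _∪_ (window-cong w v (suc m) P (λ j jl → old (<⇒≢ (+-monoʳ-< (suc m) jl)))) (cong ⁅_⁆ new))
                 (∪-comm _ _))
      go (no ne) = subst (_∈ H) (sym (window-cong w v i r (λ j jl → old (<⇒≢ (within j jl))))) (edges i (<1+n∧≢⇒< lt ne))
        where
        within : ∀ j → j < r → i + j < N
        within j (s≤s jl) = +-mono-<-≤ (<1+n∧≢⇒< lt ne) jl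

    w-in : ∀ p → p < suc N → J.lo (res p) ≤ rel base (w p) × rel base (w p) < J.hi (res p)
    w-in p lt = go (p ≟ N)
      where
      go : Dec (p ≡ N) → J.lo (res p) ≤ rel base (w p) × rel base (w p) < J.hi (res p)
      go (yes refl) = subst₂ (λ c x → J.lo c ≤ rel base x × rel base x < J.hi c) (sym res-N) (sym new) new-in
      go (no ne) = subst (λ x → J.lo (res p) ≤ rel base x × rel base x < J.hi (res p)) (sym (old ne))
                         (old-in p (<1+n∧≢⇒< lt ne))

    inSeg' : ∀ j q → j < r → j + q * r < suc (suc m) + r ∸ 1 →
             (J.lo j ≤ rel base (w (j + q * r))) × (rel base (w (j + q * r)) < J.hi j)
    inSeg' j q jl h = subst (λ c → J.lo c ≤ rel base (w (j + q * r)) × rel base (w (j + q * r)) < J.hi c)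
                            (res-of j q jl) (w-in (j + q * r) (bound h))

    predecessor : ∀ j q → j < r → j + suc q * r ≡ N → j ≡ res m × j + q * r ≡ m
    predecessor j q jl e with res-quo-unique j (suc q) (res m) (suc (quo m)) jl (res<r m) (trans e N≡res-m+)
    ... | e₁ , e₂ = e₁ , trans (cong₂ (λ a b → a + b * r) e₁ (suc-injective e₂)) (sym (res+quo m))

    earlier : ∀ j q → j + q * r < j + suc q * r
    earlier j q = +-monoʳ-< j (subst (q * r <_) (+-comm (q * r) r) (m<m+n (q * r) (s≤s z≤n)))

    evenIncr' : ∀ j q → j < r → 2 ∣ j → j + suc q * r < suc (suc m) + r ∸ 1 →
                rel base (w (j + q * r)) < rel base (w (j + suc q * r))
    evenIncr' j q jl ev h = go ((j + suc q * r) ≟ N)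
      where
      go : Dec (j + suc q * r ≡ N) → rel base (w (j + q * r)) < rel base (w (j + suc q * r))
      go (yes e) = let (e₁ , e₂) = predecessor j q jl e in
        subst₂ (λ a b → rel base a < rel base b) (sym (trans (cong w e₂) (old (<⇒≢ m<N)))) (sym (trans (cong w e) new))
               (even-step (subst (2 ∣_) e₁ ev))
      go (no ne) = let lt = <1+n∧≢⇒< (bound h) ne in
        subst₂ (λ a b → rel base a < rel base b) (sym (old (<⇒≢ (<-trans (earlier j q) lt)))) (sym (old ne))
               (evenIncr j q jl ev (inRange lt))

    oddDecr' : ∀ j q → j < r → ¬ (2 ∣ j) → j + suc q * r < suc (suc m) + r ∸ 1 →
               rel base (w (j + suc q * r)) < rel base (w (j + q * r))
    oddDecr' j q jl od h = go ((j + suc q * r) ≟ N)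
      where
      go : Dec (j + suc q * r ≡ N) → rel base (w (j + suc q * r)) < rel base (w (j + q * r))
      go (yes e) = let (e₁ , e₂) = predecessor j q jl e in
        subst₂ (λ a b → rel base a < rel base b) (sym (trans (cong w e) new)) (sym (trans (cong w e₂) (old (<⇒≢ m<N))))
               (odd-step (od ∘ subst (2 ∣_) (sym e₁)))
      go (no ne) = let lt = <1+n∧≢⇒< (bound h) ne in
        subst₂ (λ a b → rel base a < rel base b) (sym (old ne)) (sym (old (<⇒≢ (<-trans (earlier j q) lt))))
               (oddDecr j q jl od (inRange lt))

    zigzag : IsZigzag r (suc (suc m)) H w
    zigzag = J' , record
      { distinct = distinct' ; edges = edges' ; inSeg = inSeg' ; evenIncr = evenIncr' ; oddDecr = oddDecr' }
      where
      J' : Segments n r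
      J' = record { base = base ; lo = J.lo ; hi = J.hi ; lo≤hi = J.lo≤hi ; hi≤lo = J.hi≤lo ; last≤n = J.last≤n }

-- Let a be the point at position m, the
-- first point of the end, in class j₀ = res m.  If j₀ is even, a new point
-- strictly between a and the next point v (m+1) (which lies in the odd class
-- j₀+1) continues the zigzag: cut the boundary between segments j₀ and
-- j₀+1 at X (m+1).  If j₀ is odd, a new point strictly between the last
-- point v (m+P) (class j₀-1, even) and a continues it: cut the boundary
-- between segments j₀-1 and j₀ just above X (m+P).
module Continuation {n P' m : ℕ} {H : CGH n} {v : ℕ → Fin n} (I : Segments n (suc (suc P')))
                    (Z : IsZigzagWith (suc (suc P')) (suc m) H v I) (r-even : 2 ∣ suc (suc P')) where
  P : ℕ
  P = suc P'
  open Residues P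
  open Segments I
  open ZigzagFacts I Z
  open Extension I Z

  j₀ : ℕ
  j₀ = res m

  sm<N : suc m < N
  sm<N = m<m+n (suc m) (s≤s z≤n)

  module Even (ev : 2 ∣ j₀) where
    sj₀<r : suc j₀ < r
    sj₀<r = ≤∧≢⇒< (res<r m) (λ e → even⇒¬even-suc j₀ ev (subst (2 ∣_) (sym e) r-even))

    res-sm : res (suc m) ≡ suc j₀
    res-sm = trans (cong (res ∘ suc) (res+quo m)) (res-of (suc j₀) (quo m) sj₀<r)

    Xm<Xsm : X m < X (suc m)
    Xm<Xsm = res<⇒X< m (suc m) m<N sm<N (subst (j₀ <_) (sym res-sm) (n<1+n j₀))

    continue : (a' : Fin n) → X m < rel base a' → rel base a' < X (suc m) →
               ⁅ a' ⁆ ∪ window v (suc m) P ∈ H → IsZigzag r (suc (suc m)) H (setAt v N a')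
    continue a' a<a' a'<next edge = Append.zigzag a' C.cut old-in
      (C.cut-below (≤-trans (proj₁ (X∈seg m m<N)) (<⇒≤ a<a')) a'<next)
      (λ _ → a<a') (λ od → ⊥-elim (od ev)) edge
      where
      module C = Cut I j₀ (X (suc m)) sj₀<r (≤-trans (proj₁ (X∈seg m m<N)) (<⇒≤ Xm<Xsm))
                     (<⇒≤ (proj₂ (subst (λ c → lo c ≤ X (suc m) × X (suc m) < hi c) res-sm (X∈seg (suc m) sm<N))))
      old-in : ∀ i → i < N → C.lo' (res i) ≤ X i × X i < C.hi' (res i)
      old-in i lt = C.cut-mem (res i) (X∈seg i lt)
        (λ e → ≤-<-trans (even-latest i m e ev (subst (i <_) N≡m+r lt) m<N) Xm<Xsm)
        (λ e → odd-latest i (suc m) (trans e (sym res-sm)) (subst (λ c → ¬ (2 ∣ c)) (sym res-sm) (even⇒¬even-suc j₀ ev))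
                          (<-trans (subst (i <_) N≡m+r lt) (n<1+n _)) sm<N)

  module Odd (od : ¬ (2 ∣ j₀)) where
    j₁ : ℕ
    j₁ = j₀ ∸ 1

    j₀≡sj₁ : j₀ ≡ suc j₁
    j₀≡sj₁ = odd⇒suc-pred j₀ od
      where
      odd⇒suc-pred : ∀ x → ¬ (2 ∣ x) → x ≡ suc (x ∸ 1)
      odd⇒suc-pred zero o = ⊥-elim (o (divides 0 refl))
      odd⇒suc-pred (suc x) o = refl

    j₁-even : 2 ∣ j₁
    j₁-even = ¬even-suc⇒even j₁ (subst (λ c → ¬ (2 ∣ c)) j₀≡sj₁ od)

    L : ℕ
    L = m + P

    L<N : L < N
    L<N = s≤s ≤-refl

    res-L : res L ≡ j₁
    res-L = trans (cong (λ z → res (z + P)) (trans (res+quo m) (cong (_+ quo m * r) j₀≡sj₁)))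
                  (trans (cong res (regroup j₁ (quo m * r) P)) (res-of j₁ (suc (quo m)) (<-trans (n<1+n j₁) (subst (_< r) j₀≡sj₁ (res<r m)))))
      where
      regroup : ∀ a b c → suc a + b + c ≡ a + (suc c + b)
      regroup = solve-∀

    XL<Xm : X L < X m
    XL<Xm = res<⇒X< L m L<N m<N (subst₂ _<_ (sym res-L) (sym j₀≡sj₁) (n<1+n j₁))

    continue : (a' : Fin n) → X L < rel base a' → rel base a' < X m →
               ⁅ a' ⁆ ∪ window v (suc m) P ∈ H → IsZigzag r (suc (suc m)) H (setAt v N a')
    continue a' l<a' a'<a edge = Append.zigzag a' C.cut old-in
      (subst (λ c → C.lo' c ≤ rel base a' × rel base a' < C.hi' c) (sym j₀≡sj₁)
             (C.cut-above l<a' (subst (λ c → rel base a' < hi c) j₀≡sj₁ (<-trans a'<a (proj₂ (X∈seg m m<N))))))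
      (λ ev → ⊥-elim (od ev)) (λ _ → a'<a) edge
      where
      L-in : lo j₁ ≤ X L × X L < hi j₁
      L-in = subst (λ c → lo c ≤ X L × X L < hi c) res-L (X∈seg L L<N)
      module C = Cut I j₁ (suc (X L)) (subst (_< r) j₀≡sj₁ (res<r m)) (≤-trans (proj₁ L-in) (n≤1+n (X L)))
                     (subst (λ c → X L < hi c) j₀≡sj₁ (<-trans XL<Xm (proj₂ (X∈seg m m<N))))
      old-in : ∀ i → i < N → C.lo' (res i) ≤ X i × X i < C.hi' (res i)
      old-in i lt = C.cut-mem (res i) (X∈seg i lt)
        (λ e → s≤s (even-latest i L (trans e (sym res-L)) (subst (2 ∣_) (sym res-L) j₁-even)
                                  (≤-trans lt (m<m+n L (s≤s z≤n))) L<N))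
        (λ e → res<⇒X< L i L<N lt (subst₂ _<_ (sym res-L) (sym e) (n<1+n j₁)))

-- Unpacking an end a ∷ t of a (suc m)-zigzag: a is the point at position m
-- and t lists the points at positions suc m, …, m + P.
record EndWitness {n : ℕ} (P : ℕ) (H : CGH n) (m : ℕ) (a : Fin n) (t : Vec (Fin n) P) : Set where
  field
    v : ℕ → Fin n
    I : Segments n (suc P)
    Z : IsZigzagWith (suc P) (suc m) H v I
    v-first : v m ≡ a
    v-tail : tab P (λ j → v (suc m + j)) ≡ t

decode : ∀ {n P} {H : CGH n} m a t → InS (suc P) (suc m) H (a ∷ t) → EndWitness P H m a t
decode {P = P} m a t (v , (I , Z) , eq) = record
  { v = v ; I = I ; Z = Z
  ; v-first = trans (cong v (sym (+-identityʳ m))) (proj₁ (∷-injective eq))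
  ; v-tail = trans (tab-cong P _ _ (λ j _ → cong v (sym (+-suc m j)))) (proj₂ (∷-injective eq)) }

module EndWitnessFacts {n P' : ℕ} {H : CGH n} {m a t} (d : EndWitness (suc P') H m a t) where
  open EndWitness d

  head≡ : head t ≡ v (suc m)
  head≡ = trans (cong head (sym v-tail)) (cong v (+-identityʳ (suc m)))

  last≡ : last t ≡ v (m + suc P')
  last≡ = trans (cong last (sym v-tail)) (trans (last-tab P' (λ j → v (suc m + j))) (cong v (sym (+-suc m P'))))

  tail-pt : ℕ → Fin n
  tail-pt j = v (suc m + j)

  tail-sorted : ∀ j j' → j < j' → j' < suc P' → rel (v (suc m)) (tail-pt j) < rel (v (suc m)) (tail-pt j')
  tail-sorted j j' j<j' j'<P = ZigzagFacts.window-sorted I Z (suc m) j j' j<j' (<-trans j'<P (n<1+n _)) (+-monoʳ-< (suc m) j'<P)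

  ∈-shadow-set⁻ : ∀ {x} → x ∈ₛ vset (a ∷ t) - a → ∃ λ j → j < suc P' × tail-pt j ≡ x
  ∈-shadow-set⁻ h with x∈p-y⁻ h
  ... | h₁ , x≢a with x∈p∪q⁻ ⁅ a ⁆ _ h₁
  ...   | inj₁ h₂ = ⊥-elim (x≢a (x∈⁅y⁆⇒x≡y _ h₂))
  ...   | inj₂ h₂ = ∈-vset-tab⁻ (suc P') tail-pt (subst (λ z → _ ∈ₛ vset z) (sym v-tail) h₂)

  ∈-shadow-set⁺ : ∀ j → j < suc P' → tail-pt j ∈ₛ vset (a ∷ t) - a
  ∈-shadow-set⁺ j lt =
    x∈p∧x≢y⇒x∈p-y (x∈p∪q⁺ (inj₂ (subst (λ z → tail-pt j ∈ₛ vset z) v-tail (∈-vset-tab⁺ (suc P') tail-pt j lt))))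
    (λ e → <-irrefl (IsZigzagWith.distinct Z m (suc m + j) (inRange (s≤s (m≤m+n m (suc P')))) (inRange (+-monoʳ-< (suc m) lt))
                       (trans v-first (sym e)))
                    (s≤s (m≤m+n m j)))
    where open ZigzagFacts I Z using (inRange)

  head∈shadow-set : head t ∈ₛ vset (a ∷ t) - a
  head∈shadow-set = subst (_∈ₛ vset (a ∷ t) - a) (trans (cong v (+-identityʳ (suc m))) (sym head≡)) (∈-shadow-set⁺ 0 (s≤s z≤n))

-- How far a point a is from a tail t: the distance from a to the first
-- point of t, or from the last point of t to a.  Which one is relevant
-- depends on the parity of the class of a.
gap : ∀ {n P} → Bool → Fin n → Vec (Fin n) (suc P) → ℕ
gap true a t = rel a (head t)
gap false a t = rel (last t) a

gap-injective : ∀ {n P} b (t : Vec (Fin n) (suc P)) {a a'} → gap b a t ≡ gap b a' t → a ≡ a'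
gap-injective true t = rel-injectiveˡ (head t)
gap-injective false t = rel-injectiveʳ (last t)

evenClass : (P : ℕ) → ℕ → Bool
evenClass P m = does (2 ∣? Residues.res P m)

-- If a ∷ t and a' ∷ t are both ends of (suc m)-zigzags and
-- a' has the smaller gap to t, then t ∷ʳ a' is the end of a (suc m + 1)-zigzag:
-- a' lies between a and the neighbouring point of the zigzag ending in a ∷ t,
-- so that zigzag continues with a'.
glue : ∀ {n P' : ℕ} {H : CGH n} → 2 ∣ suc (suc P') → ∀ m (a a' : Fin n) (t : Vec (Fin n) (suc P')) →
  InS (suc (suc P')) (suc m) H (a ∷ t) → InS (suc (suc P')) (suc m) H (a' ∷ t) →
  gap (evenClass (suc P') m) a' t < gap (evenClass (suc P') m) a t →
  InS (suc (suc P')) (suc (suc m)) H (t ∷ʳ a')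
glue {n} {P'} {H} r-even m a a' t end end' closer = go (2 ∣? Residues.res (suc P') m) closer
  where
  open EndWitness (decode m a t end)
  open EndWitnessFacts (decode m a t end)
  module W = EndWitness (decode m a' t end')
  open Segments I using (base)
  open Continuation I Z r-even
  open Extension I Z using (N)
  open ZigzagFacts I Z using (X)

  agree : ∀ j → j < P → v (suc m + j) ≡ W.v (suc m + j)
  agree = tab-injective P _ _ (trans v-tail (sym W.v-tail))

  w-distinct : ∀ i j → i < suc m + P → j < suc m + P → W.v i ≡ W.v j → i ≡ j
  w-distinct i j li lj = IsZigzagWith.distinct W.Z i j (ZigzagFacts.inRange W.I W.Z li) (ZigzagFacts.inRange W.I W.Z lj)

  edge : ⁅ a' ⁆ ∪ window v (suc m) P ∈ H
  edge = subst (_∈ H) (cong₂ _∪_ (cong ⁅_⁆ W.v-first)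
                 (window-cong W.v v (suc m) P (λ j lt → sym (agree j lt))))
               (IsZigzagWith.edges W.Z m (n<1+n m))

  end-eq : endOf (suc P) (suc (suc m)) (setAt v N a') ≡ t ∷ʳ a'
  end-eq = trans (tab-snoc P (λ x → setAt v N a' (suc m + x)))
                 (cong₂ _∷ʳ_ (trans (tab-cong P _ _ (λ j lt → setAt-other v N a' (suc m + j) (<⇒≢ (+-monoʳ-< (suc m) lt)))) v-tail)
                             (setAt-here v N a'))

  agree-next : v (suc m) ≡ W.v (suc m)
  agree-next = subst (λ i → v i ≡ W.v i) (+-identityʳ (suc m)) (agree 0 (s≤s z≤n))

  agree-last : v (m + P) ≡ W.v (m + P)
  agree-last = subst (λ i → v i ≡ W.v i) (sym (+-suc m P')) (agree P' ≤-refl)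

  a'≢later : ∀ i → m < i → i < suc m + P → a' ≢ W.v i
  a'≢later i m<i i<N e = <⇒≢ m<i (w-distinct m i (s≤s (m≤m+n m P)) i<N (trans W.v-first e))

  go : (d : Dec (2 ∣ Residues.res P m)) → gap (does d) a' t < gap (does d) a t → InS (suc P) (suc (suc m)) H (t ∷ʳ a')
  go (yes ev) closer = setAt v N a' , Even.continue ev a' (proj₁ between) (proj₂ between) edge , end-eq
    where
    between : rel base (v m) < rel base a' × rel base a' < rel base (v (suc m))
    between = closer-to⇒between base (v m) a' (v (suc m)) (Even.Xm<Xsm ev)
                (λ e → a'≢later (suc m) (n<1+n m) (m<m+n (suc m) (s≤s z≤n)) (trans e agree-next))
                (subst₂ (λ x y → rel a' x < rel y x) head≡ (sym v-first) closer)
  go (no od) closer = setAt v N a' , Odd.continue od a' (proj₁ between) (proj₂ between) edge , end-eq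
    where
    between : rel base (v (m + P)) < rel base a' × rel base a' < rel base (v m)
    between = closer-from⇒between base (v (m + P)) (v m) a' (Odd.XL<Xm od)
                (λ e → a'≢later (m + P) (m<m+n m (s≤s z≤n)) (s≤s ≤-refl) (trans e agree-last))
                (subst₂ (λ x y → rel x a' < rel x y) last≡ (sym v-first) closer)

increasing-same-image⇒≡ : ∀ {A : Set} P (κ : A → ℕ) (g g' : ℕ → A) →
  (∀ j j' → j < j' → j' < P → κ (g j) < κ (g j')) →
  (∀ j j' → j < j' → j' < P → κ (g' j) < κ (g' j')) →
  (∀ j → j < P → ∃ λ j' → j' < P × g' j' ≡ g j) →
  (∀ j → j < P → ∃ λ j' → j' < P × g j' ≡ g' j) →
  ∀ j → j < P → g j ≡ g' j
increasing-same-image⇒≡ P κ g g' inc inc' img img' j lt = below (suc j) lt j ≤-refl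
  where
  -- If g and g' agree below j, then g j, which is some g' j', must have
  -- j' = j: j' < j would repeat a value of g, and j' > j would force
  -- g' j (some g j'') to lie strictly between two values of g.
  step : ∀ j → j < P → (∀ i → i < j → g i ≡ g' i) → g j ≡ g' j
  step j lt agree with img j lt | img' j lt
  ... | j' , l' , e₁ | j'' , l'' , e₂ with <-cmp j' j
  ...   | tri< c _ _ = ⊥-elim (<-irrefl (cong κ (trans (agree j' c) e₁)) (inc j' j c lt))
  ...   | tri≈ _ c _ = sym (trans (cong g' (sym c)) e₁)
  ...   | tri> _ _ c with <-cmp j'' j
  ...     | tri< d _ _ = ⊥-elim (<-irrefl (cong κ (trans (sym (agree j'' d)) e₂)) (inc' j'' j d lt))
  ...     | tri≈ _ d _ = trans (sym (cong g d)) e₂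
  ...     | tri> _ _ d = ⊥-elim (<-irrefl refl (<-≤-trans (subst (κ (g' j) <_) (cong κ e₁) (inc' j j' c l'))
                                                       (subst (κ (g j) ≤_) (cong κ e₂) (<⇒≤ (inc j j'' d l'')))))
  below : ∀ j → j ≤ P → ∀ i → i < j → g i ≡ g' i
  below (suc j) le i (s≤s il) with m≤n⇒m<n∨m≡n il
  ... | inj₁ c = below j (<⇒≤ le) i c
  ... | inj₂ refl = step i le (below i (<⇒≤ le))

-- The tail of an end is determined by its set (the shadow set) and its first
-- point, because it is listed clockwise from that first point.
tail-rigid : ∀ {n P'} {H : CGH n} m (a a₂ : Fin n) (t t₂ : Vec (Fin n) (suc P')) →
  InS (suc (suc P')) (suc m) H (a ∷ t) → InS (suc (suc P')) (suc m) H (a₂ ∷ t₂) →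
  vset (a ∷ t) - a ≡ vset (a₂ ∷ t₂) - a₂ → head t ≡ head t₂ → t ≡ t₂
tail-rigid {P' = P'} {H} m a a₂ t t₂ end end₂ same-set same-head =
  trans (sym (EndWitness.v-tail d₁)) (trans (tab-cong (suc P') _ _ tails-agree) (EndWitness.v-tail d₂))
  where
  d₁ : EndWitness (suc P') H m a t
  d₁ = decode m a t end
  d₂ : EndWitness (suc P') H m a₂ t₂
  d₂ = decode m a₂ t₂ end₂
  module E₁ = EndWitnessFacts d₁
  module E₂ = EndWitnessFacts d₂
  first : EndWitness.v d₂ (suc m) ≡ EndWitness.v d₁ (suc m)
  first = trans (sym E₂.head≡) (trans (sym same-head) E₁.head≡)
  tails-agree : ∀ j → j < suc P' → E₁.tail-pt j ≡ E₂.tail-pt j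
  tails-agree = increasing-same-image⇒≡ (suc P') (rel (EndWitness.v d₁ (suc m))) E₁.tail-pt E₂.tail-pt E₁.tail-sorted
    (λ j j' jj lt → subst (λ z → rel z (E₂.tail-pt j) < rel z (E₂.tail-pt j')) first (E₂.tail-sorted j j' jj lt))
    (λ j lt → E₂.∈-shadow-set⁻ (subst (E₁.tail-pt j ∈ₛ_) same-set (E₁.∈-shadow-set⁺ j lt)))
    (λ j lt → E₁.∈-shadow-set⁻ (subst (E₂.tail-pt j ∈ₛ_) (sym same-set) (E₂.∈-shadow-set⁺ j lt)))

Unique-⊆⇒length-≤ : ∀ {A : Set} (xs ys : List A) → Unique xs → (∀ {x} → x ∈ xs → x ∈ ys) → length xs ≤ length ys
Unique-⊆⇒length-≤ [] ys u h = z≤n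
Unique-⊆⇒length-≤ (x ∷ xs) ys (x∉xs ∷ u) h with ∈-∃++ (h (Any.here refl))
... | ys₁ , ys₂ , refl = subst (suc (length xs) ≤_) (sym (length-drop x ys₁ ys₂))
       (s≤s (Unique-⊆⇒length-≤ xs (ys₁ ++ ys₂) u (λ y∈xs → drop (h (Any.there y∈xs)) (≢x y∈xs x∉xs))))
  where
  drop : ∀ {y} {zs : List _} → y ∈ zs ++ x ∷ ys₂ → y ≢ x → y ∈ zs ++ ys₂
  drop {zs = []} (Any.here e) ne = ⊥-elim (ne e)
  drop {zs = []} (Any.there h) ne = h
  drop {zs = _ ∷ zs} (Any.here e) ne = Any.here e
  drop {zs = _ ∷ zs} (Any.there h) ne = Any.there (drop h ne)
  length-drop : ∀ x (zs ws : List _) → length (zs ++ x ∷ ws) ≡ suc (length (zs ++ ws))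
  length-drop x [] ws = refl
  length-drop x (_ ∷ zs) ws = cong suc (length-drop x zs ws)
  ≢x : ∀ {y} {l : List _} → y ∈ l → All (λ z → x ≢ z) l → y ≢ x
  ≢x (Any.here refl) (p ∷ _) e = p (sym e)
  ≢x (Any.there i) (_ ∷ ps) e = ≢x i ps e

Unique-map-injectiveOn : ∀ {A B : Set} (f : A → B) (xs : List A) → Unique xs →
  (∀ {x y} → x ∈ xs → y ∈ xs → f x ≡ f y → x ≡ y) → Unique (map f xs)
Unique-map-injectiveOn f [] u inj = []
Unique-map-injectiveOn f (x ∷ xs) (x∉xs ∷ u) inj =
  map-≢ xs x∉xs (λ i → i) ∷ Unique-map-injectiveOn f xs u (λ a b → inj (Any.there a) (Any.there b))
  where
  map-≢ : ∀ l → All (λ z → x ≢ z) l → (∀ {y} → y ∈ l → y ∈ xs) → All (λ z → f x ≢ z) (map f l)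
  map-≢ [] [] _ = []
  map-≢ (y ∷ l) (p ∷ ps) sub = (λ e → p (inj (Any.here refl) (Any.there (sub (Any.here refl))) e)) ∷ map-≢ l ps (sub ∘ Any.there)

length-filter-split : ∀ {A : Set} {P : A → Set} (P? : Decidable P) (xs : List A) →
  length (filter P? xs) + length (filter (¬? ∘ P?) xs) ≡ length xs
length-filter-split P? [] = refl
length-filter-split P? (x ∷ xs) with P? x
... | yes _ = cong suc (length-filter-split P? xs)
... | no _ = trans (+-suc _ _) (cong suc (length-filter-split P? xs))

elements : ∀ {n} → Subset n → List (Fin n)
elements [] = []
elements (inside ∷ p) = zero ∷ map suc (elements p)
elements (outside ∷ p) = map suc (elements p)

length-elements : ∀ {n} (p : Subset n) → length (elements p) ≡ ∣ p ∣
length-elements [] = refl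
length-elements (inside ∷ p) = cong suc (trans (length-map suc (elements p)) (length-elements p))
length-elements (outside ∷ p) = trans (length-map suc (elements p)) (length-elements p)

∈-elements⁺ : ∀ {n} (p : Subset n) {x} → x ∈ₛ p → x ∈ elements p
∈-elements⁺ (inside ∷ p) here = Any.here refl
∈-elements⁺ (inside ∷ p) (there h) = Any.there (∈-map⁺ suc (∈-elements⁺ p h))
∈-elements⁺ (outside ∷ p) (there h) = ∈-map⁺ suc (∈-elements⁺ p h)

∈-elements⁻ : ∀ {n} (p : Subset n) {x} → x ∈ elements p → x ∈ₛ p
∈-elements⁻ (inside ∷ p) (Any.here refl) = here
∈-elements⁻ (inside ∷ p) (Any.there h) with ∈-map⁻ suc h
... | y , y∈ , refl = there (∈-elements⁻ p y∈)
∈-elements⁻ (outside ∷ p) h with ∈-map⁻ suc h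
... | y , y∈ , refl = there (∈-elements⁻ p y∈)

Unique-elements : ∀ {n} (p : Subset n) → Unique (elements p)
Unique-elements [] = []
Unique-elements {suc n} (inside ∷ p) = zero∉ (elements p) ∷ Unique.map⁺ Fin-suc-injective (Unique-elements p)
  where
  zero∉ : (l : List (Fin n)) → All (λ (z : Fin (suc n)) → zero ≢ z) (map suc l)
  zero∉ [] = []
  zero∉ (x ∷ l) = (λ ()) ∷ zero∉ l
Unique-elements (outside ∷ p) = Unique.map⁺ Fin-suc-injective (Unique-elements p)

pointed : ∀ {n} → List (Subset n) → List (Subset n × Fin n)
pointed [] = []
pointed (f ∷ fs) = map (f ,_) (elements f) ++ pointed fs

length-pointed-≤ : ∀ {n} B (fs : List (Subset n)) → All (λ f → ∣ f ∣ ≤ B) fs → length (pointed fs) ≤ length fs * B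
length-pointed-≤ B [] [] = z≤n
length-pointed-≤ B (f ∷ fs) (p ∷ ps) =
  subst (_≤ B + length fs * B) (sym (trans (length-++ (map (f ,_) (elements f)))
                                           (cong (_+ length (pointed fs)) (trans (length-map _ (elements f)) (length-elements f)))))
        (+-mono-≤ p (length-pointed-≤ B fs ps))

length-pointed-≡ : ∀ {n} B (fs : List (Subset n)) → All (λ f → ∣ f ∣ ≡ B) fs → length (pointed fs) ≡ length fs * B
length-pointed-≡ B [] [] = refl
length-pointed-≡ B (f ∷ fs) (p ∷ ps) = trans (length-++ (map (f ,_) (elements f)))
  (cong₂ _+_ (trans (length-map _ (elements f)) (trans (length-elements f) p)) (length-pointed-≡ B fs ps))

∈-pointed⁺ : ∀ {n} (fs : List (Subset n)) {f x} → f ∈ fs → x ∈ₛ f → (f , x) ∈ pointed fs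
∈-pointed⁺ (g ∷ fs) (Any.here refl) x∈ = ∈-++⁺ˡ (∈-map⁺ (g ,_) (∈-elements⁺ g x∈))
∈-pointed⁺ (g ∷ fs) (Any.there f∈) x∈ = ∈-++⁺ʳ (map (g ,_) (elements g)) (∈-pointed⁺ fs f∈ x∈)

∈-pointed⁻ : ∀ {n} (fs : List (Subset n)) {f x} → (f , x) ∈ pointed fs → f ∈ fs × x ∈ₛ f
∈-pointed⁻ (g ∷ fs) h with ∈-++⁻ (map (g ,_) (elements g)) h
... | inj₁ h₁ with ∈-map⁻ (g ,_) h₁
...   | y , y∈ , refl = Any.here refl , ∈-elements⁻ g y∈
∈-pointed⁻ (g ∷ fs) h | inj₂ h₂ with ∈-pointed⁻ fs h₂
... | f∈ , x∈ = Any.there f∈ , x∈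

Unique-pointed : ∀ {n} (fs : List (Subset n)) → Unique fs → Unique (pointed fs)
Unique-pointed [] _ = []
Unique-pointed (f ∷ fs) (f∉ ∷ u) =
  Unique.++⁺ (Unique.map⁺ (cong proj₂) (Unique-elements f)) (Unique-pointed fs u) disjoint
  where
  disjoint : ∀ {p} → ¬ (p ∈ map (f ,_) (elements f) × p ∈ pointed fs)
  disjoint (h₁ , h₂) with ∈-map⁻ (f ,_) h₁
  ... | y , _ , refl = All.lookup f∉ (proj₁ (∈-pointed⁻ fs h₂)) refl

∈-shadow : ∀ {n} (H : CGH n) {e x} → e ∈ H → x ∈ₛ e → (e - x) ∈ shadow H
∈-shadow {n} H {e} {x} e∈ x∈ = ∈-deduplicate⁺ (VecP.≡-dec BoolP._≟_) (∈-concatMap⁺ shadowOf (Any.map (λ { refl → in-shadowOf }) e∈))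
  where
  in-shadowOf : (e - x) ∈ shadowOf e
  in-shadowOf = ∈-concatMap⁺ (λ y → if lookup e y then (e - y) ∷ [] else []) (Any.map (λ { refl → pick-x (lookup e x) refl }) (∈-allFin x))
    where
    pick-x : ∀ b → lookup e x ≡ b → (e - x) ∈ (if b then (e - x) ∷ [] else [])
    pick-x true _ = Any.here refl
    pick-x false eq with trans (sym ([]=⇒lookup x∈)) eq
    ... | ()

shadow-size : ∀ {n} P (H : CGH n) → All (λ e → ∣ e ∣ ≡ suc P) H → ∀ {f} → f ∈ shadow H → ∣ f ∣ ≤ P
shadow-size {n} P H sizes {f} f∈ =
  from-edge (All.lookupAny sizes (∈-concatMap⁻ shadowOf (∈-deduplicate⁻ (VecP.≡-dec BoolP._≟_) (concatMap shadowOf H) f∈)))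
  where
  from-edge : ∀ {e} → ∣ e ∣ ≡ suc P × f ∈ shadowOf e → ∣ f ∣ ≤ P
  from-edge {e} (size-e , f∈e) with Any.satisfied (∈-concatMap⁻ (λ y → if lookup e y then (e - y) ∷ [] else []) {xs = allFin n} f∈e)
  ... | x , h = go (lookup e x) refl h
    where
    go : ∀ b → lookup e x ≡ b → f ∈ (if b then (e - x) ∷ [] else []) → ∣ f ∣ ≤ P
    go true eq (Any.here refl) = ≤-pred (subst (∣ e - x ∣ <_) size-e (x∈p⇒∣p-x∣<∣p∣ (lookup⇒[]= x e eq)))

end-edge : ∀ {n P} {H : CGH n} m (e : Vec (Fin n) (suc P)) → InS (suc P) (suc m) H e → vset e ∈ H
end-edge {P = P} {H} m e (v , (I , Z) , eq) =
  subst (_∈ H) (trans (sym (vset-tab (suc P) v m)) (cong vset eq)) (IsZigzagWith.edges Z m (n<1+n m))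

-- From a duplicate-free list L of ends of (suc m)-zigzags, the ends that are
-- not the farthest (in gap) among those with the same tail extend by gluing;
-- the remaining ends inject into the pointed shadow sets via
-- a ∷ t ↦ (vset (a ∷ t) ∖ {a}, head t), so at most P |∂H| ends are lost.
module Step {n P' : ℕ} {H : CGH n} (r-even : 2 ∣ suc (suc P')) (sizes : All (λ e → ∣ e ∣ ≡ suc (suc P')) H) where
  P r : ℕ
  P = suc P'
  r = suc P

  End : Set
  End = Vec (Fin n) r

  κ : ℕ → End → ℕ
  κ m e = gap (evenClass P m) (head e) (tail e)

  Glueable : ℕ → List End → End → Set
  Glueable m L e = Any (λ e₂ → tail e₂ ≡ tail e × κ m e < κ m e₂) L

  glueable? : ∀ m L (e : End) → Dec (Glueable m L e)
  glueable? m L e = any? (λ e₂ → VecP.≡-dec Data.Fin._≟_ (tail e₂) (tail e) ×-dec (κ m e <? κ m e₂)) L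

  rotate : End → End
  rotate e = tail e ∷ʳ head e

  rotate-injective : ∀ (x y : End) → rotate x ≡ rotate y → x ≡ y
  rotate-injective (a ∷ t) (b ∷ u) e with ∷ʳ-injective t u e
  ... | refl , refl = refl

  pointedShadow : End → Subset n × Fin n
  pointedShadow e = (vset e - head e , head (tail e))

  pointedShadow-mem : ∀ m (e : End) → InS r (suc m) H e → pointedShadow e ∈ pointed (shadow H)
  pointedShadow-mem m (a ∷ t) end =
    ∈-pointed⁺ (shadow H) (∈-shadow H (end-edge m (a ∷ t) end) (x∈p∪q⁺ (inj₁ (x∈⁅x⁆ a))))
               (EndWitnessFacts.head∈shadow-set (decode m a t end))

  step : ∀ m (L : List End) → Unique L → All (InS r (suc m) H) L →
    ∃ λ L' → Unique L' × All (InS r (suc (suc m)) H) L' × length L ≤ length L' + length (shadow H) * P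
  step m L u ends = L' , Unique-L' , ends' , bound
    where
    G F L' : List End
    G = filter (glueable? m L) L
    F = filter (¬? ∘ glueable? m L) L
    L' = map rotate G

    Unique-L' : Unique L'
    Unique-L' = Unique-map-injectiveOn rotate G (Unique.filter⁺ (glueable? m L) u) (λ {x} {y} _ _ → rotate-injective x y)

    extends : ∀ {e} → e ∈ G → InS r (suc (suc m)) H (rotate e)
    extends {a ∷ t} h with ∈-filter⁻ (glueable? m L) {xs = L} h
    ... | e∈L , g = from (All.lookupAny ends g)
      where
      from : ∀ {e₂} → InS r (suc m) H e₂ × (tail e₂ ≡ t × κ m (a ∷ t) < κ m e₂) → InS r (suc (suc m)) H (rotate (a ∷ t))
      from {a₂ ∷ .t} (end₂ , refl , closer) = glue r-even m a₂ a t end₂ (All.lookup ends e∈L) closer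

    ends' : All (InS r (suc (suc m)) H) L'
    ends' = All.tabulate λ h → let (e , e∈ , eq) = ∈-map⁻ rotate h in subst (InS r (suc (suc m)) H) (sym eq) (extends e∈)

    -- Two farthest ends with the same pointed shadow set have the same tail
    -- (tail-rigid) and the same gap, hence are equal.
    injective : ∀ {x y} → x ∈ F → y ∈ F → pointedShadow x ≡ pointedShadow y → x ≡ y
    injective {a₁ ∷ t₁} {a₂ ∷ t₂} x∈ y∈ eq
      with ∈-filter⁻ (¬? ∘ glueable? m L) {xs = L} x∈ | ∈-filter⁻ (¬? ∘ glueable? m L) {xs = L} y∈
    ... | x∈L , far₁ | y∈L , far₂
      with tail-rigid m a₁ a₂ t₁ t₂ (All.lookup ends x∈L) (All.lookup ends y∈L) (cong proj₁ eq) (cong proj₂ eq)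
    ...   | refl with <-cmp (κ m (a₁ ∷ t₁)) (κ m (a₂ ∷ t₁))
    ...     | tri< c _ _ = ⊥-elim (far₁ (Any.map (λ { refl → refl , c }) y∈L))
    ...     | tri> _ _ c = ⊥-elim (far₂ (Any.map (λ { refl → refl , c }) x∈L))
    ...     | tri≈ _ c _ = cong (_∷ t₁) (gap-injective (evenClass P m) t₁ c)

    lost : length F ≤ length (shadow H) * P
    lost = ≤-trans (subst (_≤ length (pointed (shadow H))) (length-map pointedShadow F)
                     (Unique-⊆⇒length-≤ (map pointedShadow F) (pointed (shadow H))
                       (Unique-map-injectiveOn pointedShadow F (Unique.filter⁺ (¬? ∘ glueable? m L) u) injective)
                       (λ h → let (e , e∈ , eq) = ∈-map⁻ pointedShadow h in
                              subst (_∈ pointed (shadow H)) (sym eq)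
                                (pointedShadow-mem m e (All.lookup ends (proj₁ (∈-filter⁻ (¬? ∘ glueable? m L) {xs = L} e∈)))))))
                   (length-pointed-≤ P (shadow H) (All.tabulate (shadow-size P H sizes)))

    bound : length L ≤ length L' + length (shadow H) * P
    bound = begin
      length L                                  ≡⟨ sym (length-filter-split (glueable? m L) L) ⟩
      length G + length F                       ≤⟨ +-monoʳ-≤ (length G) lost ⟩
      length G + length (shadow H) * P          ≡⟨ cong (_+ length (shadow H) * P) (sym (length-map rotate G)) ⟩
      length L' + length (shadow H) * P         ∎
      where open ≤-Reasoning

-- Base case.  The i-th entry of a list (d past the end).
nth : ∀ {A : Set} → List A → A → ℕ → A
nth [] d i = d
nth (x ∷ xs) d zero = x
nth (x ∷ xs) d (suc i) = nth xs d i

nth-∈ : ∀ {A : Set} (xs : List A) d i → i < length xs → nth xs d i ∈ xs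
nth-∈ (x ∷ xs) d zero lt = Any.here refl
nth-∈ (x ∷ xs) d (suc i) (s≤s lt) = Any.there (nth-∈ xs d i lt)

∈⇒nth : ∀ {A : Set} (xs : List A) d {y} → y ∈ xs → ∃ λ i → i < length xs × nth xs d i ≡ y
∈⇒nth (x ∷ xs) d (Any.here refl) = 0 , s≤s z≤n , refl
∈⇒nth (x ∷ xs) d (Any.there h) with ∈⇒nth xs d h
... | i , lt , e = suc i , s≤s lt , e

nth-increasing : ∀ {A : Set} (κ : A → ℕ) (xs : List A) d → AllPairs (λ a b → κ a < κ b) xs →
  ∀ i j → i < j → j < length xs → κ (nth xs d i) < κ (nth xs d j)
nth-increasing κ (x ∷ xs) d (x< ∷ s) zero (suc j) _ (s≤s lt) = All.lookup x< (nth-∈ xs d j lt)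
nth-increasing κ (x ∷ xs) d (x< ∷ s) (suc i) (suc j) (s≤s ij) (s≤s lt) = nth-increasing κ xs d s i j ij lt

clockwiseFrom : ∀ {n} → Fin n → DecTotalOrder 0ℓ 0ℓ 0ℓ
clockwiseFrom x = On.decTotalOrder ≤-decTotalOrder (rel x)

sortedFrom : ∀ {n} → Fin n → Subset n → List (Fin n)
sortedFrom x e = InsertionSort.sort (clockwiseFrom x) (elements e)

sortedFrom-↭ : ∀ {n} (x : Fin n) e → sortedFrom x e ↭ elements e
sortedFrom-↭ x e = InsertionSortProperties.sort-↭ (clockwiseFrom x) (elements e)

sortedFrom-increasing : ∀ {n} (x : Fin n) e → AllPairs (λ a b → rel x a < rel x b) (sortedFrom x e)
sortedFrom-increasing {n} x e = AllPairs.zipWith (λ (le , ne) → ≤∧≢⇒< le (ne ∘ rel-injectiveʳ x))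
  ( Sorted⇒AllPairs (DecTotalOrder.totalOrder (clockwiseFrom x)) (InsertionSortProperties.sort-↗ (clockwiseFrom x) (elements e))
  , PermutationSetoid.Unique-resp-↭ (setoid (Fin n)) (↭⇒↭ₛ (↭-sym (sortedFrom-↭ x e))) (Unique-elements e))

-- The 1-zigzag listing e clockwise from x: each point in its own segment,
-- segment j being the single value  rel x (v j).
module OneZigzag {n P : ℕ} {H : CGH n} (e : Subset n) (x : Fin n) (x∈e : x ∈ₛ e)
                 (size : ∣ e ∣ ≡ suc P) (e∈H : e ∈ H) where
  r : ℕ
  r = suc P

  S : List (Fin n)
  S = sortedFrom x e

  v : ℕ → Fin n
  v = nth S x

  length-S : length S ≡ r
  length-S = trans (↭-length (sortedFrom-↭ x e)) (trans (length-elements e) size)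

  private
    <r⇒<length : ∀ {i} → i < r → i < length S
    <r⇒<length {i} = subst (i <_) (sym length-S)

  v-∈ : ∀ i → i < r → v i ∈ₛ e
  v-∈ i lt = ∈-elements⁻ e (∈-resp-↭ (sortedFrom-↭ x e) (nth-∈ S x i (<r⇒<length lt)))

  v-onto : ∀ {y} → y ∈ₛ e → ∃ λ i → i < r × v i ≡ y
  v-onto y∈ with ∈⇒nth S x (∈-resp-↭ (↭-sym (sortedFrom-↭ x e)) (∈-elements⁺ e y∈))
  ... | i , lt , eq = i , subst (i <_) length-S lt , eq

  v-increasing : ∀ i j → i < j → j < r → rel x (v i) < rel x (v j)
  v-increasing i j i<j lt = nth-increasing (rel x) S x (sortedFrom-increasing x e) i j i<j (<r⇒<length lt)

  v-first : v 0 ≡ x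
  v-first with v-onto x∈e
  ... | zero , _ , eq = eq
  ... | suc i , lt , eq = ⊥-elim (<⇒≱ (v-increasing 0 (suc i) (s≤s z≤n) lt)
                                      (subst (_≤ rel x (v 0)) (sym (trans (cong (rel x) eq) (rel-self x))) z≤n))

  v-injective : ∀ i j → i < r → j < r → v i ≡ v j → i ≡ j
  v-injective i j li lj eq with <-cmp i j
  ... | tri< c _ _ = ⊥-elim (<-irrefl (cong (rel x) eq) (v-increasing i j c lj))
  ... | tri≈ _ c _ = c
  ... | tri> _ _ c = ⊥-elim (<-irrefl (cong (rel x) (sym eq)) (v-increasing j i c li))

  window≡e : window v 0 r ≡ e
  window≡e = ⊆-antisym (λ h → let (j , lt , eq) = ∈-window⁻ v 0 r h in subst (_∈ₛ e) eq (v-∈ j lt))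
                       (λ h → let (j , lt , eq) = v-onto h in subst (_∈ₛ window v 0 r) eq (∈-window⁺ v 0 r j lt))

  private
    beyond : ∀ j q → r ≤ j + suc q * r
    beyond j q = ≤-trans (m≤m+n r (q * r)) (m≤n+m (suc q * r) j)

  zigzag : IsZigzag r 1 H v
  zigzag = segments , record
    { distinct = v-injective
    ; edges = λ { zero _ → subst (_∈ H) (sym window≡e) e∈H ; (suc i) (s≤s ()) }
    ; inSeg = in-own-segment
    ; evenIncr = λ j q _ _ h → ⊥-elim (<⇒≱ h (beyond j q))
    ; oddDecr = λ j q _ _ h → ⊥-elim (<⇒≱ h (beyond j q)) }
    where
    segments : Segments n r
    segments = record
      { base = x ; lo = λ j → rel x (v j) ; hi = λ j → suc (rel x (v j))
      ; lo≤hi = λ j _ → n≤1+n _ ; hi≤lo = λ j lt → v-increasing j (suc j) (n<1+n j) lt ; last≤n = rel<n x (v P) }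
    in-own-segment : ∀ j q → j < r → j + q * r < 1 + r ∸ 1 →
                     (rel x (v j) ≤ rel x (v (j + q * r))) × (rel x (v (j + q * r)) < suc (rel x (v j)))
    in-own-segment j zero _ _ = subst (λ z → rel x (v j) ≤ rel x (v z) × rel x (v z) < suc (rel x (v j)))
                                      (sym (+-identityʳ j)) (≤-refl , ≤-refl)
    in-own-segment j (suc q) _ h = ⊥-elim (<⇒≱ h (beyond j q))

-- |S_1(H)| ≥ r |H|: the pairs (e , x) with x ∈ e ∈ H give distinct ends
-- (the end determines e as its set and x as its first point).
base-ends : ∀ {n P} (H : CGH n) → Unique H → All (λ e → ∣ e ∣ ≡ suc P) H →
  ∃ λ L → Unique L × All (InS (suc P) 1 H) L × length L ≡ length H * suc P
base-ends {n} {P} H unique sizes = map end (pointed H) , Unique-ends , All.tabulate is-end , length-ends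
  where
  end : Subset n × Fin n → Vec (Fin n) (suc P)
  end (e , x) = endOf (suc P) 1 (nth (sortedFrom x e) x)

  module One {e x} (h : (e , x) ∈ pointed H) =
    OneZigzag {H = H} e x (proj₂ (∈-pointed⁻ H h)) (All.lookup sizes (proj₁ (∈-pointed⁻ H h))) (proj₁ (∈-pointed⁻ H h))

  is-end : ∀ {z} → z ∈ map end (pointed H) → InS (suc P) 1 H z
  is-end h with ∈-map⁻ end h
  ... | (e , x) , p∈ , refl = One.v p∈ , One.zigzag p∈ , refl

  -- vset (end (e , x)) ≡ e and head (end (e , x)) ≡ x.
  end-injective : ∀ {p p'} → p ∈ pointed H → p' ∈ pointed H → end p ≡ end p' → p ≡ p'
  end-injective {e , x} {e' , x'} p∈ p'∈ eq = cong₂ _,_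
    (trans (sym (set-of p∈)) (trans (cong vset eq) (set-of p'∈)))
    (trans (sym (One.v-first p∈)) (trans (cong head eq) (One.v-first p'∈)))
    where
    set-of : ∀ {e x} (p∈ : (e , x) ∈ pointed H) → vset (end (e , x)) ≡ e
    set-of p∈ = trans (vset-tab (suc P) (One.v p∈) 0) (One.window≡e p∈)

  Unique-ends : Unique (map end (pointed H))
  Unique-ends = Unique-map-injectiveOn end (pointed H) (Unique-pointed H unique) end-injective

  length-ends : length (map end (pointed H)) ≡ length H * suc P
  length-ends = trans (length-map end (pointed H)) (length-pointed-≡ (suc P) H sizes)

ends-bound : ∀ {n P'} (H : CGH n) → 2 ∣ suc (suc P') → Unique H → All (λ e → ∣ e ∣ ≡ suc (suc P')) H → ∀ m →
  ∃ λ (L : List (Vec (Fin n) (suc (suc P')))) → Unique L × All (InS (suc (suc P')) (suc m) H) L ×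
    length H * suc (suc P') ≤ length L + m * (length (shadow H) * suc P')
ends-bound H r-even unique sizes zero with base-ends H unique sizes
... | L , u , ends , len = L , u , ends , subst (_≤ length L + 0) len (m≤m+n (length L) 0)
ends-bound {P' = P'} H r-even unique sizes (suc m) with ends-bound H r-even unique sizes m
... | L , u , ends , le with Step.step r-even sizes m L u ends
...   | L' , u' , ends' , le' = L' , u' , ends' , (begin
  length H * suc (suc P')                              ≤⟨ le ⟩
  length L + m * lost                                  ≤⟨ +-monoˡ-≤ (m * lost) le' ⟩
  length L' + lost + m * lost                          ≡⟨ +-assoc (length L') lost (m * lost) ⟩
  length L' + suc m * lost                             ∎)
  where
  open ≤-Reasoning
  lost : ℕ
  lost = length (shadow H) * suc P'

ℕ≤⇒ℤ-≤ : ∀ a b c → a ≤ c + b → ℤ.+ a ℤ.- ℤ.+ b ℤ.≤ ℤ.+ c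
ℕ≤⇒ℤ-≤ a b c le = begin
  ℤ.+ a ℤ.- ℤ.+ b              ≤⟨ ℤ.+-monoˡ-≤ (ℤ.- ℤ.+ b) (subst (ℤ.+ a ℤ.≤_) (ℤ.pos-+ c b) (ℤ.+≤+ le)) ⟩
  (ℤ.+ c ℤ.+ ℤ.+ b) ℤ.- ℤ.+ b    ≡⟨ cancel (ℤ.+ c) (ℤ.+ b) ⟩
  ℤ.+ c                      ∎
  where
  open ℤ.≤-Reasoning
  cancel : ∀ x y → (x ℤ.+ y) ℤ.- y ≡ x
  cancel = ℤ-Solver.solve-∀

theorem3p1 : (n r k : ℕ) → 1 ≤ k → 2 ≤ r → 2 ∣ r →
    (H : List (Subset n)) → Unique H → All (λ e → ∣ e ∣ ≡ r) H →
    ∃ λ (L : List (Vec (Fin n) r)) → Unique L × All (InS r k H) L ×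
    ((ℤ.+ r) ℤ.* (ℤ.+ length H) ℤ.- (ℤ.+ (r ∸ 1)) ℤ.* (ℤ.+ (k ∸ 1)) ℤ.* (ℤ.+ length (shadow H)) ℤ.≤ ℤ.+ length L)
theorem3p1 n (suc (suc P')) (suc m) (s≤s z≤n) (s≤s (s≤s z≤n)) r-even H unique sizes with ends-bound H r-even unique sizes m
... | L , u , ends , le = L , u , ends , (begin
  ℤ.+ r ℤ.* ℤ.+ length H ℤ.- ℤ.+ P ℤ.* ℤ.+ m ℤ.* ℤ.+ s
    ≡⟨ cong₂ ℤ._-_ (sym (ℤ.pos-* r (length H)))
                   (trans (cong (ℤ._* ℤ.+ s) (sym (ℤ.pos-* P m))) (sym (ℤ.pos-* (P * m) s))) ⟩
  ℤ.+ (r * length H) ℤ.- ℤ.+ (P * m * s)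
    ≤⟨ ℕ≤⇒ℤ-≤ _ _ (length L) (subst₂ _≤_ (*-comm (length H) r) (cong (length L +_) (reorder m s P)) le) ⟩
  ℤ.+ length L
    ∎)
  where
  open ℤ.≤-Reasoning
  P r s : ℕ
  P = suc P'
  r = suc P
  s = length (shadow H)
  reorder : ∀ m s P → m * (s * P) ≡ P * m * s
  reorder = solve-∀
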